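{- Let $m>1$ be an integer. Then: (i) \[\sum_{\substack{\frac{h}{k}\in\mathcal{F}(\mathbb{B}(2m),m):\\ \frac{0}{1}<\frac{h}{k}<\frac{1}{1}}}\ \sum_{1\leq s\leq \left\lfloor\min\left\{\frac{m}{h},\ \frac{m}{k-h}\right\}\right\rfloor}\binom{m}{s h}\binom{m}{s(k-h)}=2^{2m}-2^{m+1}+1 .\] (ii) \[\sum_{\substack{\frac{h}{k}\in\mathcal{F}(\mathbb{B}(2m),m):\\ \frac{0}{1}<\frac{h}{k}<\frac{1}{2}}}\ \sum_{1\leq s\leq \left\lfloor\frac{m}{k-h}\right\rfloor}\binom{m}{s h}\binom{m}{s(k-h)}= \sum_{\substack{\frac{h}{k}\in\mathcal{F}(\mathbb{B}(2m),m):\\ \frac{1}{2}<\frac{h}{k}<\frac{1}{1}}}\ \sum_{1\leq s\leq \left\lfloor\frac{m}{h}\right\rfloor}\binom{m}{s h}\binom{m}{s(k-h)} =2^{2m-1}-2^m-\tfrac{1}{2}\binom{2m}{m}+1 .\] (iii) The four quantities \[\sum_{\substack{\frac{h}{k}\in\mathcal{F}(\mathbb{B}(2m),m):\\ \frac{0}{1}<\frac{h}{k}<\frac{1}{3}}}\ \sum_{1\leq s\leq \left\lfloor\frac{m}{k-h}\right\rfloor}\binom{m}{s(k-h)}\left(\binom{m}{s h}+\binom{m}{s (k-2h)}\right),\qquad \sum_{\substack{\frac{h}{k}\in\mathcal{F}(\mathbb{B}(2m),m):\\ \frac{1}{3}<\frac{h}{k}<\frac{1}{2}}}\ \sum_{1\leq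 s\leq \left\lfloor\frac{m}{k-h}\right\rfloor}\binom{m}{s(k-h)}\left(\binom{m}{s h}+\binom{m}{s (k-2h)}\right),\] \[\sum_{\substack{\frac{h}{k}\in\mathcal{F}(\mathbb{B}(2m),m):\\ \frac{1}{2}<\frac{h}{k}<\frac{2}{3}}}\ \sum_{1\leq s\leq \left\lfloor\frac{m}{h}\right\rfloor}\binom{m}{s h}\left(\binom{m}{s(k-h)}+\binom{m}{s(2h-k)}\right),\qquad \sum_{\substack{\frac{h}{k}\in\mathcal{F}(\mathbb{B}(2m),m):\\ \frac{2}{3}<\frac{h}{k}<\frac{1}{1}}}\ \sum_{1\leq s\leq \left\lfloor\frac{m}{h}\right\rfloor}\binom{m}{s h}\left(\binom{m}{s(k-h)}+\binom{m}{s(2h-k)}\right)\] are all equal to \[2^{2m-1}-2^m-\tfrac{1}{2}\binom{2m}{m}- \sum_{1\leq t\leq \left\lfloor\frac{m}{2}\right\rfloor}\binom{m}{2t}\binom{m}{t}+1 .\]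
   Context: For a positive integer $n$, $\mathcal{F}_n$ is the Farey sequence of order $n$: the ascending sequence of irreducible fractions $\frac hk$ with integers $0\le h\le k\le n$, $k\ge1$. For a positive integer $m$, $\mathcal{F}(\mathbb{B}(2m),m)$ is the ascending sequence $\left(\frac{h}{k}\in\mathcal{F}_{2m}:\ h\le m,\ k-h\le m\right)$. In the sums each fraction $\frac hk$ is written in lowest terms. -}

module Defs where

open import Data.Nat using (ℕ; zero; suc; _+_; _*_; _∸_; _≤_; _<_; _≤?_; _<?_)
open import Data.Nat.DivMod using (_/_)
open import Data.Nat.Coprimality using (Coprime; coprime?)
open import Data.Nat.Combinatorics using (_C_)
open import Data.Product using (_×_; _,_)
open import Data.List using (List; map; filter; concatMap; upTo)
open import Data.Nat.ListAction using (sum)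
open import Level using (0ℓ)
open import Relation.Unary using (Pred; Decidable)
open import Relation.Nullary.Decidable using (_×-dec_)
open import Data.Integer using (+_)
import Data.Rational as ℚ

-- floor(m / n) for n ≥ 1 (value 0 when n = 0; never used in that case)
⌊_/_⌋ : ℕ → ℕ → ℕ
⌊ m / zero ⌋ = 0
⌊ m / suc n ⌋ = m / suc n

Σ[1≤s≤_] : ℕ → (ℕ → ℕ) → ℕ
Σ[1≤s≤ n ] f = sum (map (λ i → f (suc i)) (upTo n))

-- A fraction h/k in lowest terms, represented by the pair (h , k).
-- Membership in F(B(2m), m): 1 ≤ k ≤ 2m, h ≤ k, gcd(h,k) = 1, h ≤ m, k - h ≤ m.
InFB : ℕ → Pred (ℕ × ℕ) 0ℓ
InFB m (h , k) = (1 ≤ k) × (k ≤ 2 * m) × (h ≤ k) × Coprime h k × (h ≤ m) × (k ∸ h ≤ m)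

inFB? : (m : ℕ) → Decidable (InFB m)
inFB? m (h , k) = (1 ≤? k) ×-dec (k ≤? 2 * m) ×-dec (h ≤? k) ×-dec coprime? h k
                  ×-dec (h ≤? m) ×-dec (k ∸ h ≤? m)

candidates : ℕ → List (ℕ × ℕ)
candidates m = concatMap (λ k → map (λ h → (h , k)) (upTo (suc k)))
                         (map suc (upTo (2 * m)))

-- the sequence F(B(2m), m) (as a list of pairs (h , k), ascending order irrelevant for sums)
FB : ℕ → List (ℕ × ℕ)
FB m = filter (inFB? m) (candidates m)

ΣFB : (m : ℕ) → {P : Pred (ℕ × ℕ) 0ℓ} → Decidable P → (ℕ → ℕ → ℕ) → ℕ
ΣFB m P? f = sum (map (λ { (h , k) → f h k }) (filter P? (FB m)))

-- interval conditions on h/k (cross-multiplied, k ≥ 1)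
-- 0/1 < h/k < 1/1
I01 : Pred (ℕ × ℕ) 0ℓ
I01 (h , k) = (0 < h) × (h < k)
I01? : Decidable I01
I01? (h , k) = (0 <? h) ×-dec (h <? k)
I0½ : Pred (ℕ × ℕ) 0ℓ
I0½ (h , k) = (0 < h) × (2 * h < k)
I0½? : Decidable I0½
I0½? (h , k) = (0 <? h) ×-dec (2 * h <? k)
I½1 : Pred (ℕ × ℕ) 0ℓ
I½1 (h , k) = (k < 2 * h) × (h < k)
I½1? : Decidable I½1
I½1? (h , k) = (k <? 2 * h) ×-dec (h <? k)
I0⅓ : Pred (ℕ × ℕ) 0ℓ
I0⅓ (h , k) = (0 < h) × (3 * h < k)
I0⅓? : Decidable I0⅓
I0⅓? (h , k) = (0 <? h) ×-dec (3 * h <? k)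
I⅓½ : Pred (ℕ × ℕ) 0ℓ
I⅓½ (h , k) = (k < 3 * h) × (2 * h < k)
I⅓½? : Decidable I⅓½
I⅓½? (h , k) = (k <? 3 * h) ×-dec (2 * h <? k)
I½⅔ : Pred (ℕ × ℕ) 0ℓ
I½⅔ (h , k) = (k < 2 * h) × (3 * h < 2 * k)
I½⅔? : Decidable I½⅔
I½⅔? (h , k) = (k <? 2 * h) ×-dec (3 * h <? 2 * k)
I⅔1 : Pred (ℕ × ℕ) 0ℓ
I⅔1 (h , k) = (2 * k < 3 * h) × (h < k)
I⅔1? : Decidable I⅔1
I⅔1? (h , k) = (2 * k <? 3 * h) ×-dec (h <? k)

ℕ→ℚ : ℕ → ℚ.ℚ
ℕ→ℚ n = + n ℚ./ 1

-- Every lattice point (a, b) of [1, m]² is uniquely s (h, k − h) with h/k ∈ F(B(2m), m)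
-- in lowest terms (s = gcd(a, b)), and then a/(a + b) = h/k.  So each double sum of the
-- statement is a sum of C(m,a) C(m,b) (or of the summand of (iii)) over the points of
-- [1, m]² lying in the cone of its Farey interval.  The whole square gives (2^m − 1)²; the
-- triangle a < b is half of it minus the diagonal Σ C(m,a)² = C(2m,m) − 1, and b < a is
-- its mirror image.  In (iii) the substitution a ↦ b − a exchanges the cones of (0, 1/3)
-- and (1/3, 1/2), so both lower sums equal the triangle a < b minus the line b = 2a; the
-- upper intervals are mirror images of the lower ones.

module Submission where

open import Defs
open import Data.Nat
  using (ℕ; zero; suc; _+_; _*_; _∸_; _^_; _<_; _≤_; _⊓_; z≤n; s≤s; _<?_; _≤?_; _≟_; ≢-nonZero; >-nonZero; >-nonZero⁻¹)
open import Data.Nat.Properties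
open import Data.Nat.Combinatorics using (_C_; nC1≡n; k>n⇒nCk≡0; nCk≡nC[n∸k]; nCk+nC[k+1]≡[n+1]C[k+1])
open import Data.Product using (_×_; _,_; proj₁; proj₂; ∃-syntax; swap)
open import Data.Product.Function.NonDependent.Propositional using (_×-⇔_)
open import Data.Unit using (⊤; tt)
open import Data.List using (List; []; _∷_; _++_; map; filter; concatMap; upTo; applyUpTo; cartesianProduct)
open import Data.Nat.ListAction using (sum)
open import Data.Nat.ListAction.Properties using (sum-++; sum-↭)
open import Data.List.Properties using (map-++; map-∘; map-cong; map-cong-local)
open import Relation.Nullary using (Dec; yes; no; ¬_; contradiction)
open import Relation.Nullary.Decidable using (_×-dec_)
open import Relation.Binary.Definitions using (tri<; tri≈; tri>)
open import Relation.Unary using (Pred; Decidable)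
open import Level using (0ℓ)
open import Function using (_∘_; flip; id)
open import Function.Bundles using (_⇔_; mk⇔; Equivalence)
open import Function.Properties.Equivalence using () renaming (trans to ⇔-trans)
open import Data.Nat.DivMod using (_/_; m/n*n≤m; m/n≤m; /-monoˡ-≤; /-monoʳ-≤; m*n/n≡m)
open import Data.Nat.Divisibility using (_∣_; divides; ∣m∣n⇒∣m+n)
open import Data.Nat.GCD using (gcd; gcd[m,n]∣m; gcd[m,n]∣n; gcd[m,n]≢0; c*gcd[m,n]≡gcd[cm,cn])
open import Data.Nat.Coprimality as Coprime using (Coprime; coprime⇒gcd≡1; gcd≡1⇒coprime; 1-coprimeTo)
open import Data.List.Membership.Propositional using (_∈_; find; lose)
open import Data.List.Membership.Propositional.Properties
  using (∈-map⁺; ∈-map⁻; ∈-applyUpTo⁺; ∈-applyUpTo⁻; ∈-upTo⁺; ∈-filter⁺; ∈-filter⁻;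
         ∈-concatMap⁺; ∈-concatMap⁻; ∈-cartesianProduct⁺; ∈-cartesianProduct⁻)
open import Data.List.Membership.Propositional.Properties.WithK using (unique∧set⇒bag)
open import Data.List.Relation.Binary.BagAndSetEquality using (∼bag⇒↭)
open import Data.List.Relation.Binary.Permutation.Propositional using (_↭_)
import Data.List.Relation.Binary.Permutation.Propositional.Properties as ↭
import Data.List.Relation.Unary.All as All
open import Data.List.Relation.Unary.Any using (here; there)
open import Data.Empty using (⊥)
open import Data.List.Relation.Unary.Unique.Propositional using (Unique; []; _∷_)
import Data.List.Relation.Unary.Unique.Propositional.Properties as Unique
open import Data.Sum using (inj₁)
open import Relation.Binary.PropositionalEquality
import Data.Integer as ℤ
import Data.Integer.Properties as ℤ
open import Data.Rational using (ℚ; ½; 1ℚ; mkℚ) renaming (_+_ to _+ℚ_; _-_ to _-ℚ_; _*_ to _*ℚ_)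
open import Data.Rational.Properties using (↥p/↧p≡p; /-cong)
import Data.Rational.Solver as ℚ-Solver
import Data.Nat.Solver as ℕ-Solver
open ≡-Reasoning
open import Algebra.Properties.CommutativeSemigroup +-commutativeSemigroup
  using () renaming (interchange to +-interchange; x∙yz≈y∙xz to x+[y+z]≡y+[x+z])
open import Algebra.Properties.CommutativeSemigroup *-commutativeSemigroup
  using () renaming (x∙yz≈y∙xz to x*[y*z]≡y*[x*z])


Σ< : ℕ → (ℕ → ℕ) → ℕ
Σ< zero    f = 0
Σ< (suc n) f = f 0 + Σ< n (f ∘ suc)

Σ<-cong : ∀ n {f g : ℕ → ℕ} → (∀ {i} → i < n → f i ≡ g i) → Σ< n f ≡ Σ< n g
Σ<-cong zero    eq = refl
Σ<-cong (suc n) eq = cong₂ _+_ (eq (s≤s z≤n)) (Σ<-cong n (eq ∘ s≤s))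

Σ<-zeros : ∀ n {f : ℕ → ℕ} → (∀ {i} → i < n → f i ≡ 0) → Σ< n f ≡ 0
Σ<-zeros n eq = trans (Σ<-cong n eq) (zeros n)
  where
  zeros : ∀ n → Σ< n (λ _ → 0) ≡ 0
  zeros zero    = refl
  zeros (suc n) = zeros n

Σ<-distrib-+ : ∀ n (f g : ℕ → ℕ) → Σ< n (λ i → f i + g i) ≡ Σ< n f + Σ< n g
Σ<-distrib-+ zero    f g = refl
Σ<-distrib-+ (suc n) f g =
  trans (cong (f 0 + g 0 +_) (Σ<-distrib-+ n (f ∘ suc) (g ∘ suc))) (+-interchange (f 0) (g 0) _ _)

*-distribˡ-Σ< : ∀ n c (f : ℕ → ℕ) → c * Σ< n f ≡ Σ< n (λ i → c * f i)
*-distribˡ-Σ< zero    c f = *-zeroʳ c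
*-distribˡ-Σ< (suc n) c f = trans (*-distribˡ-+ c (f 0) _) (cong (c * f 0 +_) (*-distribˡ-Σ< n c (f ∘ suc)))

Σ<-comm : ∀ n p (f : ℕ → ℕ → ℕ) → Σ< n (λ i → Σ< p (f i)) ≡ Σ< p (λ j → Σ< n (λ i → f i j))
Σ<-comm zero    p f = sym (Σ<-zeros p (λ _ → refl))
Σ<-comm (suc n) p f = begin
  Σ< p (f 0) + Σ< n (λ i → Σ< p (f (suc i)))        ≡⟨ cong (Σ< p (f 0) +_) (Σ<-comm n p (f ∘ suc)) ⟩
  Σ< p (f 0) + Σ< p (λ j → Σ< n (λ i → f (suc i) j)) ≡⟨ Σ<-distrib-+ p (f 0) _ ⟨
  Σ< p (λ j → f 0 j + Σ< n (λ i → f (suc i) j))      ∎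

Σ<-snoc : ∀ n (f : ℕ → ℕ) → Σ< (suc n) f ≡ Σ< n f + f n
Σ<-snoc zero    f = +-comm (f 0) 0
Σ<-snoc (suc n) f = trans (cong (f 0 +_) (Σ<-snoc n (f ∘ suc))) (sym (+-assoc (f 0) _ _))

Σ<-truncate : ∀ {n p} (f : ℕ → ℕ) → n ≤ p → (∀ {i} → n ≤ i → i < p → f i ≡ 0) → Σ< p f ≡ Σ< n f
Σ<-truncate {zero}          f _         eq = Σ<-zeros _ (eq z≤n)
Σ<-truncate {suc n} {suc p} f (s≤s n≤p) eq =
  cong (f 0 +_) (Σ<-truncate (f ∘ suc) n≤p (λ n≤i i<p → eq (s≤s n≤i) (s≤s i<p)))

Σ<-reverse : ∀ n (f : ℕ → ℕ) → Σ< n f ≡ Σ< n (λ i → f (n ∸ suc i))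
Σ<-reverse zero    f = refl
Σ<-reverse (suc n) f = begin
  f 0 + Σ< n (f ∘ suc)                     ≡⟨ cong (f 0 +_) (Σ<-reverse n (f ∘ suc)) ⟩
  f 0 + Σ< n (λ i → f (suc (n ∸ suc i)))   ≡⟨ +-comm (f 0) _ ⟩
  Σ< n (λ i → f (suc (n ∸ suc i))) + f 0
    ≡⟨ cong₂ _+_ (Σ<-cong n (cong f ∘ sym ∘ +-∸-assoc 1)) (cong f (sym (n∸n≡0 n))) ⟩
  Σ< n (λ i → f (n ∸ i)) + f (n ∸ n)       ≡⟨ Σ<-snoc n (λ i → f (n ∸ i)) ⟨
  Σ< (suc n) (λ i → f (n ∸ i))             ∎

Σ<-single : ∀ {n c} (f : ℕ → ℕ) → c < n → (∀ {i} → i < n → i ≢ c → f i ≡ 0) → Σ< n f ≡ f c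
Σ<-single {suc n} {zero}  f _         eq = trans (cong (f 0 +_) (Σ<-zeros n (λ i<n → eq (s≤s i<n) λ ()))) (+-identityʳ (f 0))
Σ<-single {suc n} {suc c} f (s≤s c<n) eq =
  cong₂ _+_ (eq (s≤s z≤n) λ ()) (Σ<-single (f ∘ suc) c<n (λ i<n i≢c → eq (s≤s i<n) (i≢c ∘ suc-injective)))

sum-map-applyUpTo : ∀ {A : Set} (f : A → ℕ) (g : ℕ → A) n → sum (map f (applyUpTo g n)) ≡ Σ< n (f ∘ g)
sum-map-applyUpTo f g zero    = refl
sum-map-applyUpTo f g (suc n) = cong (f (g 0) +_) (sum-map-applyUpTo f (g ∘ suc) n)

Σ[1≤s≤]≡Σ< : ∀ n (f : ℕ → ℕ) → Σ[1≤s≤ n ] f ≡ Σ< n (f ∘ suc)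
Σ[1≤s≤]≡Σ< n f = sum-map-applyUpTo (f ∘ suc) id n


infixr 8 [_]·_

[_]·_ : ∀ {p} {P : Set p} → Dec P → ℕ → ℕ
[ yes _ ]· x = x
[ no _  ]· x = 0

[]·-yes : ∀ {p} {P : Set p} (d : Dec P) {x} → P → [ d ]· x ≡ x
[]·-yes (yes _) _ = refl
[]·-yes (no ¬p) p = contradiction p ¬p

[]·-no : ∀ {p} {P : Set p} (d : Dec P) {x} → ¬ P → [ d ]· x ≡ 0
[]·-no (yes p) ¬p = contradiction p ¬p
[]·-no (no _)  _  = refl

[]·-cong : ∀ {p q} {P : Set p} {Q : Set q} (d : Dec P) (e : Dec Q) {x y} →
           (P → Q) → (Q → P) → (P → x ≡ y) → [ d ]· x ≡ [ e ]· y
[]·-cong (yes p) (yes _) _  _  x≡y = x≡y p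
[]·-cong (yes p) (no ¬q) pq _  _   = contradiction (pq p) ¬q
[]·-cong (no ¬p) (yes q) _  qp _   = contradiction (qp q) ¬p
[]·-cong (no _)  (no _)  _  _  _   = refl

[]·-distrib-+ : ∀ {p} {P : Set p} (d : Dec P) x y → [ d ]· (x + y) ≡ [ d ]· x + [ d ]· y
[]·-distrib-+ (yes _) x y = refl
[]·-distrib-+ (no _)  x y = refl

[]·-[]· : ∀ {p q} {P : Set p} {Q : Set q} (d : Dec P) (e : Dec Q) {x} → [ d ]· [ e ]· x ≡ [ d ×-dec e ]· x
[]·-[]· (yes _) (yes _) = refl
[]·-[]· (yes _) (no _)  = refl
[]·-[]· (no _)  _       = refl


module _ {A : Set} where

  sum-map-filter : ∀ {P : Pred A 0ℓ} (P? : Decidable P) (f : A → ℕ) xs →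
                   sum (map f (filter P? xs)) ≡ sum (map (λ x → [ P? x ]· f x) xs)
  sum-map-filter P? f []       = refl
  sum-map-filter P? f (x ∷ xs) with P? x
  ... | yes _ = cong (f x +_) (sum-map-filter P? f xs)
  ... | no _  = sum-map-filter P? f xs

  sum-map-concatMap : ∀ {B : Set} (f : B → ℕ) (g : A → List B) xs →
                      sum (map f (concatMap g xs)) ≡ sum (map (sum ∘ map f ∘ g) xs)
  sum-map-concatMap f g []       = refl
  sum-map-concatMap f g (x ∷ xs) = begin
    sum (map f (g x ++ concatMap g xs))              ≡⟨ cong sum (map-++ f (g x) _) ⟩
    sum (map f (g x) ++ map f (concatMap g xs))      ≡⟨ sum-++ (map f (g x)) _ ⟩
    sum (map f (g x)) + sum (map f (concatMap g xs)) ≡⟨ cong (sum (map f (g x)) +_) (sum-map-concatMap f g xs) ⟩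
    sum (map f (g x)) + sum (map (sum ∘ map f ∘ g) xs) ∎

  sum-map-cartesianProduct : ∀ {B : Set} (f : A × B → ℕ) xs ys →
    sum (map f (cartesianProduct xs ys)) ≡ sum (map (λ x → sum (map (λ y → f (x , y)) ys)) xs)
  sum-map-cartesianProduct f []       ys = refl
  sum-map-cartesianProduct f (x ∷ xs) ys = begin
    sum (map f (map (x ,_) ys ++ cartesianProduct xs ys))
      ≡⟨ cong sum (map-++ f (map (x ,_) ys) _) ⟩
    sum (map f (map (x ,_) ys) ++ map f (cartesianProduct xs ys))
      ≡⟨ sum-++ (map f (map (x ,_) ys)) _ ⟩
    sum (map f (map (x ,_) ys)) + sum (map f (cartesianProduct xs ys))
      ≡⟨ cong₂ _+_ (cong sum (sym (map-∘ ys))) (sum-map-cartesianProduct f xs ys) ⟩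
    sum (map (λ y → f (x , y)) ys) + sum (map (λ x → sum (map (λ y → f (x , y)) ys)) xs) ∎

module _ {A : Set} where

  ↭-unique : {xs ys : List A} → Unique xs → Unique ys →
             (∀ {z} → z ∈ xs → z ∈ ys) → (∀ {z} → z ∈ ys → z ∈ xs) → xs ↭ ys
  ↭-unique ux uy xs⊆ys ys⊆xs = ∼bag⇒↭ (unique∧set⇒bag ux uy (mk⇔ xs⊆ys ys⊆xs))

  concatMap-unique : ∀ {B : Set} (f : A → List B) {xs} → Unique xs →
    (∀ {x} → x ∈ xs → Unique (f x)) →
    (∀ {x y z} → x ∈ xs → y ∈ xs → z ∈ f x → z ∈ f y → x ≡ y) →
    Unique (concatMap f xs)
  concatMap-unique f {[]}     _             _   _    = []
  concatMap-unique f {x ∷ xs} (x∉xs ∷ uxs) ufx same =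
    Unique.++⁺ (ufx (here refl))
      (concatMap-unique f uxs (ufx ∘ there) (λ x∈ y∈ → same (there x∈) (there y∈)))
      disjoint
    where
    disjoint : ∀ {z} → z ∈ f x × z ∈ concatMap f xs → ⊥
    disjoint (z∈fx , z∈rest) with find (∈-concatMap⁻ f z∈rest)
    ... | y , y∈xs , z∈fy with same (here refl) (there y∈xs) z∈fx z∈fy
    ...   | refl = All.lookup x∉xs y∈xs refl


-- The square [1, m]²

Σ[1≤a,b≤_] : ℕ → (ℕ → ℕ → ℕ) → ℕ
Σ[1≤a,b≤ m ] F = Σ< m (λ i → Σ< m (λ j → F (suc i) (suc j)))

infixl 5 _⇂_

_⇂_ : (ℕ → ℕ → ℕ) → {K : Pred (ℕ × ℕ) 0ℓ} → Decidable K → ℕ → ℕ → ℕ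
(F ⇂ K?) a b = [ K? (a , b) ]· F a b

range : ℕ → List ℕ
range = applyUpTo suc

grid : ℕ → List (ℕ × ℕ)
grid m = cartesianProduct (range m) (range m)

sum-map-grid : ∀ m (F : ℕ × ℕ → ℕ) → sum (map F (grid m)) ≡ Σ[1≤a,b≤ m ] (λ a b → F (a , b))
sum-map-grid m F = begin
  sum (map F (grid m))
    ≡⟨ sum-map-cartesianProduct F (range m) (range m) ⟩
  sum (map (λ a → sum (map (λ b → F (a , b)) (range m))) (range m))
    ≡⟨ sum-map-applyUpTo _ suc m ⟩
  Σ< m (λ i → sum (map (λ b → F (suc i , b)) (range m)))
    ≡⟨ Σ<-cong m (λ {i} _ → sum-map-applyUpTo (λ b → F (suc i , b)) suc m) ⟩
  Σ[1≤a,b≤ m ] (λ a b → F (a , b)) ∎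

Σ[1≤a,b≤]-cong : ∀ m {F G : ℕ → ℕ → ℕ} → (∀ {a b} → 0 < a → 0 < b → F a b ≡ G a b) →
                 Σ[1≤a,b≤ m ] F ≡ Σ[1≤a,b≤ m ] G
Σ[1≤a,b≤]-cong m eq = Σ<-cong m (λ _ → Σ<-cong m (λ _ → eq (s≤s z≤n) (s≤s z≤n)))

Σ[1≤a,b≤]-distrib-+ : ∀ m (F G : ℕ → ℕ → ℕ) →
  Σ[1≤a,b≤ m ] (λ a b → F a b + G a b) ≡ Σ[1≤a,b≤ m ] F + Σ[1≤a,b≤ m ] G
Σ[1≤a,b≤]-distrib-+ m F G = trans (Σ<-cong m (λ {i} _ → Σ<-distrib-+ m (F (suc i) ∘ suc) (G (suc i) ∘ suc)))
                                  (Σ<-distrib-+ m _ _)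

Σ[1≤a,b≤]-comm : ∀ m (F : ℕ → ℕ → ℕ) → Σ[1≤a,b≤ m ] F ≡ Σ[1≤a,b≤ m ] (flip F)
Σ[1≤a,b≤]-comm m F = Σ<-comm m m (λ i j → F (suc i) (suc j))

Σ[1≤a,b≤]-* : ∀ m (f g : ℕ → ℕ) → Σ[1≤a,b≤ m ] (λ a b → f a * g b) ≡ Σ< m (f ∘ suc) * Σ< m (g ∘ suc)
Σ[1≤a,b≤]-* m f g = begin
  Σ< m (λ i → Σ< m (λ j → f (suc i) * g (suc j)))  ≡⟨ Σ<-cong m (λ {i} _ → *-distribˡ-Σ< m (f (suc i)) (g ∘ suc)) ⟨
  Σ< m (λ i → f (suc i) * Σ< m (g ∘ suc))           ≡⟨ Σ<-cong m (λ {i} _ → *-comm (f (suc i)) _) ⟩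
  Σ< m (λ i → Σ< m (g ∘ suc) * f (suc i))           ≡⟨ *-distribˡ-Σ< m (Σ< m (g ∘ suc)) (f ∘ suc) ⟨
  Σ< m (g ∘ suc) * Σ< m (f ∘ suc)                   ≡⟨ *-comm (Σ< m (g ∘ suc)) _ ⟩
  Σ< m (f ∘ suc) * Σ< m (g ∘ suc)                   ∎

Σ<-[suc≟]· : ∀ m c (f : ℕ → ℕ) → 0 < c → Σ< m (λ j → [ suc j ≟ c ]· f (suc j)) ≡ [ c ≤? m ]· f c
Σ<-[suc≟]· m (suc c) f _ with c <? m
... | yes c<m = trans (Σ<-single _ c<m (λ _ j≢c → []·-no (suc _ ≟ suc c) (j≢c ∘ suc-injective)))
                      ([]·-yes (suc c ≟ suc c) refl)
... | no c≮m  = Σ<-zeros m (λ j<m → []·-no (suc _ ≟ suc c) (λ j≡c → c≮m (subst (_< m) (suc-injective j≡c) j<m)))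

Σ[1≤a,b≤]-line : ∀ m (φ : ℕ → ℕ) (F : ℕ → ℕ → ℕ) → (∀ {a} → 0 < a → 0 < φ a) →
  Σ[1≤a,b≤ m ] (λ a b → [ b ≟ φ a ]· F a b) ≡ Σ< m (λ i → [ φ (suc i) ≤? m ]· F (suc i) (φ (suc i)))
Σ[1≤a,b≤]-line m φ F φ-positive = Σ<-cong m (λ {i} _ → Σ<-[suc≟]· m (φ (suc i)) (F (suc i)) (φ-positive (s≤s z≤n)))

∈-range⁺ : ∀ {m a} → 0 < a → a ≤ m → a ∈ range m
∈-range⁺ {a = suc a} _ a≤m = ∈-applyUpTo⁺ suc a≤m

∈-range⁻ : ∀ {m a} → a ∈ range m → 0 < a × a ≤ m
∈-range⁻ a∈ with ∈-applyUpTo⁻ suc a∈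
... | _ , i<m , refl = s≤s z≤n , i<m

grid-unique : ∀ m → Unique (grid m)
grid-unique m = Unique.cartesianProduct⁺ range-unique range-unique
  where
  range-unique : Unique (range m)
  range-unique = Unique.applyUpTo⁺₁ suc m (λ i<j _ → <⇒≢ i<j ∘ suc-injective)


-- Scaling by the gcd

≤⌊/⌋⇔*≤ : ∀ {m d s} → 0 < d → s ≤ ⌊ m / d ⌋ ⇔ s * d ≤ m
≤⌊/⌋⇔*≤ {m} {suc d} {s} _ = mk⇔
  (λ s≤m/d → ≤-trans (*-monoˡ-≤ (suc d) s≤m/d) (m/n*n≤m m (suc d)))
  (λ sd≤m → subst (_≤ m / suc d) (m*n/n≡m s (suc d)) (/-monoˡ-≤ (suc d) sd≤m))

≤⌊/⌋⊓⌊/⌋⇔ : ∀ {m h j s} → 0 < h → 0 < j → s ≤ ⌊ m / h ⌋ ⊓ ⌊ m / j ⌋ ⇔ (s * h ≤ m × s * j ≤ m)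
≤⌊/⌋⊓⌊/⌋⇔ 0<h 0<j = mk⇔
  (λ s≤ → Equivalence.to (≤⌊/⌋⇔*≤ 0<h) (m≤n⊓o⇒m≤n _ _ s≤) ,
          Equivalence.to (≤⌊/⌋⇔*≤ 0<j) (m≤n⊓o⇒m≤o _ _ s≤))
  (λ (sh≤m , sj≤m) → ⊓-glb (Equivalence.from (≤⌊/⌋⇔*≤ 0<h) sh≤m) (Equivalence.from (≤⌊/⌋⇔*≤ 0<j) sj≤m))

⌊/⌋⊓⌊/⌋≡ʳ : ∀ {m h j} → 0 < h → h ≤ j → ⌊ m / h ⌋ ⊓ ⌊ m / j ⌋ ≡ ⌊ m / j ⌋
⌊/⌋⊓⌊/⌋≡ʳ {m} {suc _} {suc _} _ h≤j = m≥n⇒m⊓n≡n (/-monoʳ-≤ m h≤j)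

⌊/⌋⊓⌊/⌋≡ˡ : ∀ {m h j} → 0 < j → j ≤ h → ⌊ m / h ⌋ ⊓ ⌊ m / j ⌋ ≡ ⌊ m / h ⌋
⌊/⌋⊓⌊/⌋≡ˡ {m} {suc _} {suc _} _ j≤h = m≤n⇒m⊓n≡m (/-monoʳ-≤ m j≤h)

gcd[s*h,s*j]≡s : ∀ s {h j} → Coprime h j → gcd (s * h) (s * j) ≡ s
gcd[s*h,s*j]≡s s {h} {j} c = begin
  gcd (s * h) (s * j) ≡⟨ c*gcd[m,n]≡gcd[cm,cn] s h j ⟨
  s * gcd h j         ≡⟨ cong (s *_) (coprime⇒gcd≡1 c) ⟩
  s * 1               ≡⟨ *-identityʳ s ⟩
  s                   ∎

coprime-decomposition : ∀ {a} b → 0 < a →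
  ∃[ g ] ∃[ h ] ∃[ j ] (0 < g × Coprime h j × a ≡ g * h × b ≡ g * j)
coprime-decomposition {a} b 0<a
  with gcd[m,n]∣m a b | gcd[m,n]∣n a b | gcd[m,n]≢0 a b (inj₁ (m<n⇒n≢0 0<a))
... | divides h a≡hg | divides j b≡jg | g≢0 =
  g , h , j , n≢0⇒n>0 g≢0 , gcd≡1⇒coprime gcd[h,j]≡1 , a≡gh , b≡gj
  where
  g : ℕ
  g = gcd a b
  a≡gh : a ≡ g * h
  a≡gh = trans a≡hg (*-comm h g)
  b≡gj : b ≡ g * j
  b≡gj = trans b≡jg (*-comm j g)
  gcd[h,j]≡1 : gcd h j ≡ 1
  gcd[h,j]≡1 = *-cancelˡ-≡ (gcd h j) 1 g {{≢-nonZero g≢0}} (begin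
    g * gcd h j         ≡⟨ c*gcd[m,n]≡gcd[cm,cn] g h j ⟩
    gcd (g * h) (g * j) ≡⟨ cong₂ gcd a≡gh b≡gj ⟨
    g                   ≡⟨ *-identityʳ g ⟨
    g * 1               ∎)

coprime-∸ : ∀ {h k} → h ≤ k → Coprime h k → Coprime h (k ∸ h)
coprime-∸ h≤k c (d∣h , d∣k∸h) = c (d∣h , subst (_ ∣_) (m+[n∸m]≡n h≤k) (∣m∣n⇒∣m+n d∣h d∣k∸h))


-- Fractions of F(B(2m), m) and their multiples

candidates-unique : ∀ m → Unique (candidates m)
candidates-unique m = concatMap-unique _ (Unique.map⁺ suc-injective (Unique.upTo⁺ _))
  (λ _ → Unique.map⁺ (cong proj₁) (Unique.upTo⁺ _)) same-denominator
  where
  same-denominator : ∀ {k k' z} → k ∈ map suc (upTo (2 * m)) → k' ∈ map suc (upTo (2 * m)) →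
                     z ∈ map (_, k) (upTo (suc k)) → z ∈ map (_, k') (upTo (suc k')) → k ≡ k'
  same-denominator {k} {k'} _ _ z∈ z∈' with ∈-map⁻ (_, k) z∈ | ∈-map⁻ (_, k') z∈'
  ... | _ , _ , refl | _ , _ , z≡ = cong proj₂ z≡

∈-FB⁺ : ∀ {m h k} → InFB m (h , k) → (h , k) ∈ FB m
∈-FB⁺ {m} {h} {suc k} inFB@(_ , k<2m , h≤k , _) = ∈-filter⁺ (inFB? m)
  (∈-concatMap⁺ _ (lose (∈-map⁺ suc (∈-upTo⁺ k<2m)) (∈-map⁺ (_, suc k) (∈-upTo⁺ (s≤s h≤k))))) inFB

∈-filter-FB⁻ : ∀ m {P : Pred (ℕ × ℕ) 0ℓ} (P? : Decidable P) {x} → x ∈ filter P? (FB m) → P x × InFB m x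
∈-filter-FB⁻ m P? x∈ with ∈-filter⁻ P? {xs = FB m} x∈
... | x∈FB , p = p , proj₂ (∈-filter⁻ (inFB? m) {xs = candidates m} x∈FB)

coprime⇒InFB : ∀ {m h j} → 0 < h → h ≤ m → j ≤ m → Coprime h j → InFB m (h , h + j)
coprime⇒InFB {m} {h} {j} 0<h h≤m j≤m c =
  ≤-trans 0<h (m≤m+n h j) , +-mono-≤ h≤m (subst (j ≤_) (sym (+-identityʳ m)) j≤m) , m≤m+n h j ,
  Coprime.sym (Coprime.coprime-+ (Coprime.sym c)) , h≤m , subst (_≤ m) (sym (m+n∸m≡n h j)) j≤m

multiple : ℕ × ℕ → ℕ → ℕ × ℕ
multiple (h , k) i = suc i * h , suc i * (k ∸ h)

multiples : ℕ → ℕ × ℕ → List (ℕ × ℕ)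
multiples m (h , k) = applyUpTo (multiple (h , k)) (⌊ m / h ⌋ ⊓ ⌊ m / (k ∸ h) ⌋)

Homogeneous : Pred (ℕ × ℕ) 0ℓ → Set
Homogeneous K = ∀ {s a b} → 0 < s → K (a , b) ⇔ K (s * a , s * b)

-- K (a , b) says that the fraction a / (a + b) satisfies P.
record IsConeOver (P K : Pred (ℕ × ℕ) 0ℓ) : Set where
  field
    positive    : ∀ {h k} → P (h , k) → 0 < h × h < k
    trace       : ∀ {h j} → 0 < h → 0 < j → P (h , h + j) ⇔ K (h , j)
    homogeneous : Homogeneous K

  P⇒K : ∀ {h k} → P (h , k) → K (h , k ∸ h)
  P⇒K {h} p with positive p
  ... | 0<h , h<k = Equivalence.to (trace 0<h (m<n⇒0<n∸m h<k))
                      (subst (λ k → P (h , k)) (sym (m+[n∸m]≡n (<⇒≤ h<k))) p)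

  bound≡⌊m/[k∸h]⌋ : ∀ {m h k} → (∀ {a b} → K (a , b) → a ≤ b) → P (h , k) →
                    ⌊ m / h ⌋ ⊓ ⌊ m / (k ∸ h) ⌋ ≡ ⌊ m / (k ∸ h) ⌋
  bound≡⌊m/[k∸h]⌋ a≤b p = ⌊/⌋⊓⌊/⌋≡ʳ (proj₁ (positive p)) (a≤b (P⇒K p))

  bound≡⌊m/h⌋ : ∀ {m h k} → (∀ {a b} → K (a , b) → b ≤ a) → P (h , k) →
                ⌊ m / h ⌋ ⊓ ⌊ m / (k ∸ h) ⌋ ≡ ⌊ m / h ⌋
  bound≡⌊m/h⌋ b≤a p = ⌊/⌋⊓⌊/⌋≡ˡ (m<n⇒0<n∸m (proj₂ (positive p))) (b≤a (P⇒K p))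

module _ (m : ℕ) {P K : Pred (ℕ × ℕ) 0ℓ} (P? : Decidable P) (K? : Decidable K) (cone : IsConeOver P K) where

  open IsConeOver cone

  private
    fractions : List (ℕ × ℕ)
    fractions = filter P? (FB m)

    ∈-fractions⁻ : ∀ {x} → x ∈ fractions → P x × InFB m x
    ∈-fractions⁻ = ∈-filter-FB⁻ m P?

    multiples-unique : ∀ {x} → x ∈ fractions → Unique (multiples m x)
    multiples-unique {h , k} x∈ =
      Unique.applyUpTo⁺₁ _ _ (λ i<j _ eq → <⇒≢ i<j (suc-injective (*-cancelʳ-≡ _ _ h {{>-nonZero 0<h}} (cong proj₁ eq))))
      where
      0<h : 0 < h
      0<h = proj₁ (positive (proj₁ (∈-fractions⁻ x∈)))

    multiples-disjoint : ∀ {x y z} → x ∈ fractions → y ∈ fractions → z ∈ multiples m x → z ∈ multiples m y → x ≡ y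
    multiples-disjoint {h , k} {h' , k'} x∈ y∈ z∈ z∈'
      with ∈-fractions⁻ x∈ | ∈-fractions⁻ y∈
         | ∈-applyUpTo⁻ (multiple (h , k)) z∈ | ∈-applyUpTo⁻ (multiple (h' , k')) z∈'
    ... | _ , (_ , _ , h≤k , c , _) | _ , (_ , _ , h'≤k' , c' , _) | i , _ , refl | i' , _ , z≡ =
      cong₂ _,_ h≡h' (begin
        k                ≡⟨ m+[n∸m]≡n h≤k ⟨
        h + (k ∸ h)      ≡⟨ cong₂ _+_ h≡h' j≡j' ⟩
        h' + (k' ∸ h')   ≡⟨ m+[n∸m]≡n h'≤k' ⟩
        k'               ∎)
      where
      s≡s' : suc i ≡ suc i'
      s≡s' = begin
        suc i                                     ≡⟨ gcd[s*h,s*j]≡s (suc i) (coprime-∸ h≤k c) ⟨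
        gcd (suc i * h) (suc i * (k ∸ h))         ≡⟨ cong₂ gcd (cong proj₁ z≡) (cong proj₂ z≡) ⟩
        gcd (suc i' * h') (suc i' * (k' ∸ h'))    ≡⟨ gcd[s*h,s*j]≡s (suc i') (coprime-∸ h'≤k' c') ⟩
        suc i'                                    ∎
      h≡h' : h ≡ h'
      h≡h' = *-cancelˡ-≡ h h' (suc i) (trans (cong proj₁ z≡) (cong (_* h') (sym s≡s')))
      j≡j' : k ∸ h ≡ k' ∸ h'
      j≡j' = *-cancelˡ-≡ (k ∸ h) (k' ∸ h') (suc i) (trans (cong proj₂ z≡) (cong (_* (k' ∸ h')) (sym s≡s')))

    pairs : List (ℕ × ℕ)
    pairs = filter K? (grid m)

    multiples⊆pairs : ∀ {z} → z ∈ concatMap (multiples m) fractions → z ∈ pairs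
    multiples⊆pairs z∈ with find (∈-concatMap⁻ (multiples m) {xs = fractions} z∈)
    ... | (h , k) , x∈ , z∈mult with ∈-fractions⁻ x∈ | ∈-applyUpTo⁻ (multiple (h , k)) z∈mult
    ...   | p , _ | i , i<U , refl with positive p
    ...     | 0<h , h<k with Equivalence.to (≤⌊/⌋⊓⌊/⌋⇔ 0<h (m<n⇒0<n∸m h<k)) i<U
    ...       | a≤m , b≤m = ∈-filter⁺ K?
      (∈-cartesianProduct⁺ (∈-range⁺ (scaled-positive 0<h) a≤m) (∈-range⁺ (scaled-positive (m<n⇒0<n∸m h<k)) b≤m))
      (Equivalence.to (homogeneous {s = suc i} (s≤s z≤n)) (P⇒K p))
      where
      scaled-positive : ∀ {x} → 0 < x → 0 < suc i * x
      scaled-positive {x} 0<x = ≤-trans 0<x (m≤n*m x (suc i))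

    pairs⊆multiples : ∀ {z} → z ∈ pairs → z ∈ concatMap (multiples m) fractions
    pairs⊆multiples {a , b} z∈ with ∈-filter⁻ K? {xs = grid m} z∈
    ... | z∈grid , κ with ∈-cartesianProduct⁻ (range m) (range m) z∈grid
    ...   | a∈ , b∈ with ∈-range⁻ a∈ | ∈-range⁻ b∈
    ...     | 0<a , a≤m | 0<b , b≤m with coprime-decomposition b 0<a
    ...       | suc g , h , j , 0<g , c , refl , refl =
      ∈-concatMap⁺ (multiples m) (lose (∈-filter⁺ P? (∈-FB⁺ inFB) p) (subst (_∈ multiples m (h , h + j)) gh,gj≡ g∈))
      where
      0<h : 0 < h
      0<h = >-nonZero⁻¹ h {{m*n≢0⇒n≢0 (suc g) {{>-nonZero 0<a}}}}
      0<j : 0 < j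
      0<j = >-nonZero⁻¹ j {{m*n≢0⇒n≢0 (suc g) {{>-nonZero 0<b}}}}
      j≡ : h + j ∸ h ≡ j
      j≡ = m+n∸m≡n h j
      p : P (h , h + j)
      p = Equivalence.from (trace 0<h 0<j) (Equivalence.from (homogeneous 0<g) κ)
      inFB : InFB m (h , h + j)
      inFB = coprime⇒InFB 0<h (≤-trans (m≤n*m h (suc g)) a≤m) (≤-trans (m≤n*m j (suc g)) b≤m) c
      g∈ : multiple (h , h + j) g ∈ multiples m (h , h + j)
      g∈ = ∈-applyUpTo⁺ (multiple (h , h + j)) {i = g}
             (Equivalence.from (≤⌊/⌋⊓⌊/⌋⇔ {s = suc g} 0<h (subst (0 <_) (sym j≡) 0<j))
                               (a≤m , subst (λ j → suc g * j ≤ m) (sym j≡) b≤m))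
      gh,gj≡ : multiple (h , h + j) g ≡ (suc g * h , suc g * j)
      gh,gj≡ = cong (λ j → suc g * h , suc g * j) j≡

  farey-grid : (G : ℕ → ℕ → ℕ) →
    ΣFB m P? (λ h k → Σ[1≤s≤ ⌊ m / h ⌋ ⊓ ⌊ m / (k ∸ h) ⌋ ] (λ s → G (s * h) (s * (k ∸ h))))
      ≡ Σ[1≤a,b≤ m ] (G ⇂ K?)
  farey-grid G = begin
    ΣFB m P? (λ h k → Σ[1≤s≤ ⌊ m / h ⌋ ⊓ ⌊ m / (k ∸ h) ⌋ ] (λ s → G (s * h) (s * (k ∸ h))))
      ≡⟨ cong sum (map-cong (λ (h , k) → let U = ⌊ m / h ⌋ ⊓ ⌊ m / (k ∸ h) ⌋ in
         trans (Σ[1≤s≤]≡Σ< U (λ s → G (s * h) (s * (k ∸ h)))) (sym (sum-map-applyUpTo G' (multiple (h , k)) U))) fractions) ⟩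
    sum (map (sum ∘ map G' ∘ multiples m) fractions)
      ≡⟨ sum-map-concatMap G' (multiples m) fractions ⟨
    sum (map G' (concatMap (multiples m) fractions))
      ≡⟨ sum-↭ (↭.map⁺ G' (↭-unique concatMap-multiples-unique (Unique.filter⁺ K? (grid-unique m))
                                     multiples⊆pairs pairs⊆multiples)) ⟩
    sum (map G' pairs)
      ≡⟨ sum-map-filter K? G' (grid m) ⟩
    sum (map (λ z → [ K? z ]· G' z) (grid m))
      ≡⟨ sum-map-grid m _ ⟩
    Σ[1≤a,b≤ m ] (G ⇂ K?) ∎
    where
    G' : ℕ × ℕ → ℕ
    G' (a , b) = G a b
    concatMap-multiples-unique : Unique (concatMap (multiples m) fractions)
    concatMap-multiples-unique = concatMap-unique (multiples m)
      (Unique.filter⁺ P? (Unique.filter⁺ (inFB? m) (candidates-unique m))) multiples-unique multiples-disjoint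

ΣFB-cong : ∀ m {P : Pred (ℕ × ℕ) 0ℓ} (P? : Decidable P) {f g : ℕ → ℕ → ℕ} →
           (∀ {h k} → P (h , k) → f h k ≡ g h k) → ΣFB m P? f ≡ ΣFB m P? g
ΣFB-cong m P? eq = cong sum (map-cong-local {xs = filter P? (FB m)}
  (All.tabulate (λ {(h , k)} x∈ → eq (proj₁ (∈-filter-FB⁻ m P? x∈)))))

Σ[1≤s≤]-cong : ∀ {n n'} {f g : ℕ → ℕ} → n ≡ n' → (∀ s → f s ≡ g s) → Σ[1≤s≤ n ] f ≡ Σ[1≤s≤ n' ] g
Σ[1≤s≤]-cong {n} refl eq = cong sum (map-cong (eq ∘ suc) (upTo n))

farey-grid′ : ∀ m {P K : Pred (ℕ × ℕ) 0ℓ} (P? : Decidable P) (K? : Decidable K) → IsConeOver P K →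
  (U : ℕ → ℕ → ℕ) (F : ℕ → ℕ → ℕ → ℕ) (G : ℕ → ℕ → ℕ) →
  (∀ {h k} → P (h , k) → ⌊ m / h ⌋ ⊓ ⌊ m / (k ∸ h) ⌋ ≡ U h k) →
  (∀ {h k} → P (h , k) → ∀ s → G (s * h) (s * (k ∸ h)) ≡ F h k s) →
  ΣFB m P? (λ h k → Σ[1≤s≤ U h k ] (F h k)) ≡ Σ[1≤a,b≤ m ] (G ⇂ K?)
farey-grid′ m P? K? cone U F G bound summand =
  trans (ΣFB-cong m P? (λ p → sym (Σ[1≤s≤]-cong (bound p) (summand p)))) (farey-grid m P? K? cone G)

module _ (m : ℕ) {P K : Pred (ℕ × ℕ) 0ℓ} (P? : Decidable P) (K? : Decidable K) (cone : IsConeOver P K)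
         (F : ℕ → ℕ → ℕ → ℕ) (G : ℕ → ℕ → ℕ)
         (summand : ∀ {h k} → P (h , k) → ∀ s → G (s * h) (s * (k ∸ h)) ≡ F h k s) where

  open IsConeOver cone

  farey-grid-⌊m/[k∸h]⌋ : (∀ {a b} → K (a , b) → a ≤ b) →
                         ΣFB m P? (λ h k → Σ[1≤s≤ ⌊ m / (k ∸ h) ⌋ ] (F h k)) ≡ Σ[1≤a,b≤ m ] (G ⇂ K?)
  farey-grid-⌊m/[k∸h]⌋ a≤b = farey-grid′ m P? K? cone (λ h k → ⌊ m / (k ∸ h) ⌋) F G
                               (λ {h} {k} → bound≡⌊m/[k∸h]⌋ {m} {h} {k} a≤b) summand

  farey-grid-⌊m/h⌋ : (∀ {a b} → K (a , b) → b ≤ a) →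
                     ΣFB m P? (λ h k → Σ[1≤s≤ ⌊ m / h ⌋ ] (F h k)) ≡ Σ[1≤a,b≤ m ] (G ⇂ K?)
  farey-grid-⌊m/h⌋ b≤a = farey-grid′ m P? K? cone (λ h k → ⌊ m / h ⌋) F G
                           (λ {h} {k} → bound≡⌊m/h⌋ {m} {h} {k} b≤a) summand


-- Cones over the Farey intervals

scaled-<⇔ : ∀ {s x y x' y'} → 0 < s → x' ≡ s * x → y' ≡ s * y → x < y ⇔ x' < y'
scaled-<⇔ {suc s} {x} {y} _ refl refl = mk⇔ (*-monoʳ-< (suc s)) (*-cancelˡ-< (suc s) x y)

shifted-<⇔ : ∀ c {x y x' y'} → x' ≡ c + x → y' ≡ c + y → x' < y' ⇔ x < y
shifted-<⇔ c {x} {y} refl refl = mk⇔ (+-cancelˡ-< c x y) (+-monoʳ-< c)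

2*n≡n+n : ∀ n → 2 * n ≡ n + n
2*n≡n+n n = cong (n +_) (+-identityʳ n)

Cone0½ Cone0⅓ Cone⅓½ Cone½1 Cone½⅔ Cone⅔1 : Pred (ℕ × ℕ) 0ℓ
Cone0½ (a , b) = a < b
Cone0⅓ (a , b) = 2 * a < b
Cone⅓½ (a , b) = b < 2 * a × a < b
Cone½1 = Cone0½ ∘ swap
Cone½⅔ = Cone⅓½ ∘ swap
Cone⅔1 = Cone0⅓ ∘ swap

Cone0½? : Decidable Cone0½
Cone0½? (a , b) = a <? b

Cone0⅓? : Decidable Cone0⅓
Cone0⅓? (a , b) = 2 * a <? b

Cone⅓½? : Decidable Cone⅓½
Cone⅓½? (a , b) = (b <? 2 * a) ×-dec (a <? b)

Cone½1? : Decidable Cone½1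
Cone½1? = Cone0½? ∘ swap

Cone½⅔? : Decidable Cone½⅔
Cone½⅔? = Cone⅓½? ∘ swap

Cone⅔1? : Decidable Cone⅔1
Cone⅔1? = Cone0⅓? ∘ swap

Cone0½-homogeneous : Homogeneous Cone0½
Cone0½-homogeneous 0<s = scaled-<⇔ 0<s refl refl

Cone0⅓-homogeneous : Homogeneous Cone0⅓
Cone0⅓-homogeneous {s} {a} 0<s = scaled-<⇔ 0<s (x*[y*z]≡y*[x*z] 2 s a) refl

Cone⅓½-homogeneous : Homogeneous Cone⅓½
Cone⅓½-homogeneous {s} {a} 0<s = scaled-<⇔ 0<s refl (x*[y*z]≡y*[x*z] 2 s a) ×-⇔ scaled-<⇔ 0<s refl refl

I01-cone : IsConeOver I01 (λ _ → ⊤)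
I01-cone = record
  { positive    = λ p → p
  ; trace       = λ {h} 0<h 0<j → mk⇔ (λ _ → tt) (λ _ → 0<h , m<m+n h 0<j)
  ; homogeneous = λ _ → mk⇔ (λ _ → tt) (λ _ → tt)
  }

I0½-cone : IsConeOver I0½ Cone0½
I0½-cone = record
  { positive    = λ {h} (0<h , 2h<k) → 0<h , ≤-<-trans (m≤n*m h 2) 2h<k
  ; trace       = λ {h} 0<h _ → let h+h<h+j⇔h<j = shifted-<⇔ h (2*n≡n+n h) refl in
                    mk⇔ (Equivalence.to h+h<h+j⇔h<j ∘ proj₂) (λ h<j → 0<h , Equivalence.from h+h<h+j⇔h<j h<j)
  ; homogeneous = Cone0½-homogeneous
  }

I½1-cone : IsConeOver I½1 Cone½1
I½1-cone = record
  { positive    = λ { {suc _} (_ , h<k) → s≤s z≤n , h<k }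
  ; trace       = λ {h} {j} _ 0<j → mk⇔ (Equivalence.to (shifted-<⇔ h refl (2*n≡n+n h)) ∘ proj₁)
                    (λ j<h → Equivalence.from (shifted-<⇔ h refl (2*n≡n+n h)) j<h , m<m+n h 0<j)
  ; homogeneous = λ 0<s → Cone0½-homogeneous 0<s
  }

I0⅓-cone : IsConeOver I0⅓ Cone0⅓
I0⅓-cone = record
  { positive    = λ {h} (0<h , 3h<k) → 0<h , ≤-<-trans (m≤n*m h 3) 3h<k
  ; trace       = λ {h} 0<h _ → mk⇔ (Equivalence.to (shifted-<⇔ h refl refl) ∘ proj₂)
                    (λ 2h<j → 0<h , Equivalence.from (shifted-<⇔ h refl refl) 2h<j)
  ; homogeneous = Cone0⅓-homogeneous
  }

I⅓½-cone : IsConeOver I⅓½ Cone⅓½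
I⅓½-cone = record
  { positive    = λ { {suc h} (_ , 2h<k) → s≤s z≤n , ≤-<-trans (m≤n*m (suc h) 2) 2h<k }
  ; trace       = λ {h} _ _ → shifted-<⇔ h refl refl ×-⇔ shifted-<⇔ h (2*n≡n+n h) refl
  ; homogeneous = Cone⅓½-homogeneous
  }

I½⅔-cone : IsConeOver I½⅔ Cone½⅔
I½⅔-cone = record
  { positive    = λ { {suc h} (_ , 3h<2k) → s≤s z≤n , 3h<2k⇒h<k 3h<2k }
  ; trace       = λ {h} {j} _ _ → ⇔-trans
                    (shifted-<⇔ h refl (2*n≡n+n h) ×-⇔ shifted-<⇔ (2 * h) (3h≡2h+h h) (*-distribˡ-+ 2 h j))
                    (mk⇔ swap swap)
  ; homogeneous = λ 0<s → Cone⅓½-homogeneous 0<s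
  }
  where
  3h≡2h+h : ∀ h → 3 * h ≡ 2 * h + h
  3h≡2h+h h = +-comm h (2 * h)
  3h<2k⇒h<k : ∀ {h k} → 3 * h < 2 * k → h < k
  3h<2k⇒h<k {h} 3h<2k =
    ≰⇒> (λ k≤h → <⇒≱ 3h<2k (≤-trans (*-monoʳ-≤ 2 k≤h) (*-monoˡ-≤ h {2} {3} (s≤s (s≤s z≤n)))))

I⅔1-cone : IsConeOver I⅔1 Cone⅔1
I⅔1-cone = record
  { positive    = λ { {suc _} (_ , h<k) → s≤s z≤n , h<k }
  ; trace       = λ {h} {j} _ 0<j → let 2h+2j<2h+h⇔2j<h = shifted-<⇔ (2 * h) (*-distribˡ-+ 2 h j) (+-comm h (2 * h)) in
                    mk⇔ (Equivalence.to 2h+2j<2h+h⇔2j<h ∘ proj₁) (λ 2j<h → Equivalence.from 2h+2j<2h+h⇔2j<h 2j<h , m<m+n h 0<j)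
  ; homogeneous = λ 0<s → Cone0⅓-homogeneous 0<s
  }


-- Splitting the triangle a < b

[]·-trichotomy : ∀ a b x → x ≡ [ a <? b ]· x + [ b <? a ]· x + [ b ≟ a ]· x
[]·-trichotomy a b x with <-cmp a b
... | tri< a<b a≢b b≮a
  rewrite []·-yes (a <? b) {x} a<b | []·-no (b <? a) {x} b≮a | []·-no (b ≟ a) {x} (a≢b ∘ sym)
  = sym (trans (+-identityʳ _) (+-identityʳ x))
... | tri≈ a≮b a≡b b≮a
  rewrite []·-no (a <? b) {x} a≮b | []·-no (b <? a) {x} b≮a | []·-yes (b ≟ a) {x} (sym a≡b) = refl
... | tri> a≮b a≢b b<a
  rewrite []·-no (a <? b) {x} a≮b | []·-yes (b <? a) {x} b<a | []·-no (b ≟ a) {x} (a≢b ∘ sym) = sym (+-identityʳ x)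

[]·-split-at-double : ∀ {a} b x → 0 < a →
  [ a <? b ]· x ≡ [ 2 * a <? b ]· x + [ Cone⅓½? (a , b) ]· x + [ b ≟ 2 * a ]· x
[]·-split-at-double {a} b x 0<a = trans ([]·-trichotomy (2 * a) b y) (cong₂ _+_ (cong₂ _+_
  ([]·-cong (2 * a <? b) (2 * a <? b) id id (λ 2a<b → []·-yes (a <? b) (<-trans a<2a 2a<b)))
  ([]·-[]· (b <? 2 * a) (a <? b)))
  ([]·-cong (b ≟ 2 * a) (b ≟ 2 * a) id id (λ b≡2a → []·-yes (a <? b) (subst (a <_) (sym b≡2a) a<2a))))
  where
  y : ℕ
  y = [ a <? b ]· x
  a<2a : a < 2 * a
  a<2a = subst (a <_) (sym (2*n≡n+n a)) (m<m+n a 0<a)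

[]·-reflect : ∀ a a' (φ : ℕ → ℕ) → 0 < a →
  [ 2 * a <? a + a' ]· φ (a + a' ∸ a) ≡ [ Cone⅓½? (a' , a + a') ]· φ a'
[]·-reflect a a' φ 0<a = []·-cong (2 * a <? a + a') (Cone⅓½? (a' , a + a'))
  (λ 2a<a+a' → let a<a' = Equivalence.to 2a<a+a'⇔a<a' 2a<a+a' in Equivalence.from a+a'<2a'⇔a<a' a<a' , m<n+m a' 0<a)
  (Equivalence.from 2a<a+a'⇔a<a' ∘ Equivalence.to a+a'<2a'⇔a<a' ∘ proj₁)
  (λ _ → cong φ (m+n∸m≡n a a'))
  where
  2a<a+a'⇔a<a' : 2 * a < a + a' ⇔ a < a'
  2a<a+a'⇔a<a' = shifted-<⇔ a (2*n≡n+n a) refl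
  a+a'<2a'⇔a<a' : a + a' < 2 * a' ⇔ a < a'
  a+a'<2a'⇔a<a' = shifted-<⇔ a' (+-comm a a') (2*n≡n+n a')

Σ<-reflect : ∀ {m} b → b ≤ m → (φ : ℕ → ℕ) →
  Σ< m (λ i → [ 2 * suc i <? b ]· φ (b ∸ suc i)) ≡ Σ< m (λ i → [ Cone⅓½? (suc i , b) ]· φ (suc i))
Σ<-reflect {m} zero _ φ =
  trans (Σ<-zeros m (λ {i} _ → []·-no (2 * suc i <? 0) {φ (0 ∸ suc i)} λ ()))
        (sym (Σ<-zeros m (λ {i} _ → []·-no (Cone⅓½? (suc i , 0)) {φ (suc i)} (λ { (_ , ()) }))))
Σ<-reflect {m} (suc b) 1+b≤m φ = begin
  Σ< m f                      ≡⟨ Σ<-truncate f b≤m (λ b≤i _ → []·-no (2 * suc _ <? suc b)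
                                                    (λ lt → <⇒≱ lt (≤-trans (s≤s b≤i) (m≤n*m _ 2)))) ⟩
  Σ< b f                      ≡⟨ Σ<-reverse b f ⟩
  Σ< b (λ i → f (b ∸ suc i))  ≡⟨ Σ<-cong b reflected ⟩
  Σ< b g                      ≡⟨ Σ<-truncate g b≤m (λ b≤i _ → []·-no (Cone⅓½? (suc _ , suc b))
                                                    (λ c → <⇒≱ (proj₂ c) (s≤s b≤i))) ⟨
  Σ< m g                      ∎
  where
  f g : ℕ → ℕ
  f i = [ 2 * suc i <? suc b ]· φ (suc b ∸ suc i)
  g i = [ Cone⅓½? (suc i , suc b) ]· φ (suc i)
  b≤m : b ≤ m
  b≤m = <⇒≤ 1+b≤m
  reflected : ∀ {i} → i < b → f (b ∸ suc i) ≡ g i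
  reflected {i} i<b = subst (λ c → [ 2 * a <? c ]· φ (c ∸ a) ≡ [ Cone⅓½? (suc i , c) ]· φ (suc i)) a+1+i≡1+b
                            ([]·-reflect a (suc i) φ (s≤s z≤n))
    where
    a : ℕ
    a = suc (b ∸ suc i)
    a+1+i≡1+b : a + suc i ≡ suc b
    a+1+i≡1+b = begin
      suc (b ∸ suc i) + suc i  ≡⟨ cong (_+ suc i) (+-∸-assoc 1 i<b) ⟨
      (b ∸ i) + suc i          ≡⟨ +-suc (b ∸ i) i ⟩
      suc (b ∸ i + i)          ≡⟨ cong suc (m∸n+n≡m (<⇒≤ i<b)) ⟩
      suc b                    ∎

Σ[1≤a,b≤]-reflect : ∀ m (F : ℕ → ℕ → ℕ) →
  Σ[1≤a,b≤ m ] (λ a b → [ Cone0⅓? (a , b) ]· F b (b ∸ a)) ≡ Σ[1≤a,b≤ m ] (λ a b → [ Cone⅓½? (a , b) ]· F b a)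
Σ[1≤a,b≤]-reflect m F = begin
  Σ[1≤a,b≤ m ] (λ a b → [ Cone0⅓? (a , b) ]· F b (b ∸ a))
    ≡⟨ Σ[1≤a,b≤]-comm m (λ a b → [ Cone0⅓? (a , b) ]· F b (b ∸ a)) ⟩
  Σ[1≤a,b≤ m ] (λ b a → [ Cone0⅓? (a , b) ]· F b (b ∸ a))
    ≡⟨ Σ<-cong m (λ {j} j<m → Σ<-reflect (suc j) j<m (F (suc j))) ⟩
  Σ[1≤a,b≤ m ] (λ b a → [ Cone⅓½? (a , b) ]· F b a)
    ≡⟨ Σ[1≤a,b≤]-comm m (λ a b → [ Cone⅓½? (a , b) ]· F b a) ⟨
  Σ[1≤a,b≤ m ] (λ a b → [ Cone⅓½? (a , b) ]· F b a) ∎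


-- Binomial sums

Σ[i≤n]nCi≡2^n : ∀ n → Σ< (suc n) (n C_) ≡ 2 ^ n
Σ[i≤n]nCi≡2^n zero    = refl
Σ[i≤n]nCi≡2^n (suc n) = begin
  1 + Σ< (suc n) (λ i → suc n C suc i)
    ≡⟨ cong (1 +_) (Σ<-cong (suc n) (λ {i} _ → sym (nCk+nC[k+1]≡[n+1]C[k+1] n i))) ⟩
  1 + Σ< (suc n) (λ i → n C i + n C suc i)               ≡⟨ cong (1 +_) (Σ<-distrib-+ (suc n) (n C_) (λ i → n C suc i)) ⟩
  1 + (S + Σ< (suc n) (λ i → n C suc i))                 ≡⟨ x+[y+z]≡y+[x+z] 1 S _ ⟩
  S + Σ< (suc (suc n)) (n C_)                            ≡⟨ cong (S +_) (Σ<-snoc (suc n) (n C_)) ⟩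
  S + (S + n C suc n)                                    ≡⟨ cong (λ c → S + (S + c)) (k>n⇒nCk≡0 (n<1+n n)) ⟩
  S + (S + 0)                                            ≡⟨ cong (λ x → x + (x + 0)) (Σ[i≤n]nCi≡2^n n) ⟩
  2 ^ suc n                                              ∎
  where
  S : ℕ
  S = Σ< (suc n) (n C_)

Σ[i≤k]mCi*nC[k∸i]≡[m+n]Ck : ∀ m n k → Σ< (suc k) (λ i → (m C i) * (n C (k ∸ i))) ≡ (m + n) C k
Σ[i≤k]mCi*nC[k∸i]≡[m+n]Ck zero    n k       =
  trans (cong₂ _+_ (*-identityˡ (n C k)) (Σ<-zeros k (λ _ → refl))) (+-identityʳ _)
Σ[i≤k]mCi*nC[k∸i]≡[m+n]Ck (suc m) n zero    = refl
Σ[i≤k]mCi*nC[k∸i]≡[m+n]Ck (suc m) n (suc k) = begin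
  1 * (n C suc k) + Σ< (suc k) (λ i → (suc m C suc i) * (n C (k ∸ i)))
    ≡⟨ cong (1 * (n C suc k) +_) (Σ<-cong (suc k) (λ {i} _ → pascal i)) ⟩
  1 * (n C suc k) + Σ< (suc k) (λ i → (m C i) * (n C (k ∸ i)) + (m C suc i) * (n C (k ∸ i)))
    ≡⟨ cong (1 * (n C suc k) +_) (Σ<-distrib-+ (suc k) conv (λ i → (m C suc i) * (n C (k ∸ i)))) ⟩
  1 * (n C suc k) + (Σ< (suc k) (λ i → (m C i) * (n C (k ∸ i))) + Σ< (suc k) (λ i → (m C suc i) * (n C (k ∸ i))))
    ≡⟨ x+[y+z]≡y+[x+z] (1 * (n C suc k)) (Σ< (suc k) conv) _ ⟩
  Σ< (suc k) (λ i → (m C i) * (n C (k ∸ i))) + Σ< (suc (suc k)) (λ i → (m C i) * (n C (suc k ∸ i)))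
    ≡⟨ cong₂ _+_ (Σ[i≤k]mCi*nC[k∸i]≡[m+n]Ck m n k) (Σ[i≤k]mCi*nC[k∸i]≡[m+n]Ck m n (suc k)) ⟩
  (m + n) C k + (m + n) C suc k
    ≡⟨ nCk+nC[k+1]≡[n+1]C[k+1] (m + n) k ⟩
  suc (m + n) C suc k ∎
  where
  conv : ℕ → ℕ
  conv i = (m C i) * (n C (k ∸ i))
  pascal : ∀ i → (suc m C suc i) * (n C (k ∸ i)) ≡ (m C i) * (n C (k ∸ i)) + (m C suc i) * (n C (k ∸ i))
  pascal i = trans (cong (_* (n C (k ∸ i))) (sym (nCk+nC[k+1]≡[n+1]C[k+1] m i))) (*-distribʳ-+ (n C (k ∸ i)) (m C i) (m C suc i))

Σ[i≤n]nCi²≡[2n]Cn : ∀ n → Σ< (suc n) (λ i → (n C i) * (n C i)) ≡ (2 * n) C n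
Σ[i≤n]nCi²≡[2n]Cn n = begin
  Σ< (suc n) (λ i → (n C i) * (n C i))
    ≡⟨ Σ<-cong (suc n) (λ {i} i<1+n → cong ((n C i) *_) (nCk≡nC[n∸k] (≤-pred i<1+n))) ⟩
  Σ< (suc n) (λ i → (n C i) * (n C (n ∸ i)))
    ≡⟨ Σ[i≤k]mCi*nC[k∸i]≡[m+n]Ck n n n ⟩
  (n + n) C n
    ≡⟨ cong (_C n) (2*n≡n+n n) ⟨
  (2 * n) C n ∎

B : ℕ → ℕ → ℕ → ℕ
B m a b = (m C a) * (m C b)

triangle : ℕ → ℕ
triangle m = Σ[1≤a,b≤ m ] (B m ⇂ Cone0½?)

B∸ : ℕ → ℕ → ℕ → ℕ
B∸ m a b = (m C b) * (m C (b ∸ a))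

B+B∸ : ℕ → ℕ → ℕ → ℕ
B+B∸ m a b = B m a b + B∸ m a b

doubling : ℕ → ℕ
doubling m = Σ[1≤s≤ ⌊ m / 2 ⌋ ] (λ t → (m C (2 * t)) * (m C t))

Diagonal : Pred (ℕ × ℕ) 0ℓ
Diagonal (a , b) = b ≡ a

Diagonal? : Decidable Diagonal
Diagonal? (a , b) = b ≟ a

Doubled : Pred (ℕ × ℕ) 0ℓ
Doubled (a , b) = b ≡ 2 * a

Doubled? : Decidable Doubled
Doubled? (a , b) = b ≟ 2 * a

module _ (m : ℕ) where

  Σ[1≤a,b≤]-B : Σ[1≤a,b≤ m ] (B m) ≡ Σ< m (λ i → m C suc i) * Σ< m (λ i → m C suc i)
  Σ[1≤a,b≤]-B = Σ[1≤a,b≤]-* m (m C_) (m C_)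

  Σ[1≤a,b≤]-B⇂Cone½1≡triangle : Σ[1≤a,b≤ m ] (B m ⇂ Cone½1?) ≡ triangle m
  Σ[1≤a,b≤]-B⇂Cone½1≡triangle = trans (Σ[1≤a,b≤]-comm m (B m ⇂ Cone½1?))
    (Σ[1≤a,b≤]-cong m (λ {a} {b} _ _ → cong ([ a <? b ]·_) (*-comm (m C b) (m C a))))

  triangle+triangle+Σ[1≤a≤m]mCa² : triangle m + triangle m + Σ< m (λ i → (m C suc i) * (m C suc i)) ≡ Σ[1≤a,b≤ m ] (B m)
  triangle+triangle+Σ[1≤a≤m]mCa² = begin
    triangle m + triangle m + Σ< m (λ i → (m C suc i) * (m C suc i))
      ≡⟨ cong₂ (λ u v → triangle m + u + v) (sym Σ[1≤a,b≤]-B⇂Cone½1≡triangle) (sym diagonal) ⟩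
    Σ[1≤a,b≤ m ] (B m ⇂ Cone0½?) + Σ[1≤a,b≤ m ] (B m ⇂ Cone½1?) + Σ[1≤a,b≤ m ] (B m ⇂ Diagonal?)
      ≡⟨ cong (_+ Σ[1≤a,b≤ m ] (B m ⇂ Diagonal?)) (Σ[1≤a,b≤]-distrib-+ m (B m ⇂ Cone0½?) (B m ⇂ Cone½1?)) ⟨
    Σ[1≤a,b≤ m ] (λ a b → (B m ⇂ Cone0½?) a b + (B m ⇂ Cone½1?) a b) + Σ[1≤a,b≤ m ] (B m ⇂ Diagonal?)
      ≡⟨ Σ[1≤a,b≤]-distrib-+ m (λ a b → (B m ⇂ Cone0½?) a b + (B m ⇂ Cone½1?) a b) (B m ⇂ Diagonal?) ⟨
    Σ[1≤a,b≤ m ] (λ a b → (B m ⇂ Cone0½?) a b + (B m ⇂ Cone½1?) a b + (B m ⇂ Diagonal?) a b)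
      ≡⟨ Σ[1≤a,b≤]-cong m (λ {a} {b} _ _ → []·-trichotomy a b (B m a b)) ⟨
    Σ[1≤a,b≤ m ] (B m) ∎
    where
    diagonal : Σ[1≤a,b≤ m ] (B m ⇂ Diagonal?) ≡ Σ< m (λ i → (m C suc i) * (m C suc i))
    diagonal = trans (Σ[1≤a,b≤]-line m id (B m) id) (Σ<-cong m (λ {i} i<m → []·-yes (suc i ≤? m) i<m))

  Σ[1≤a,b≤]-B⇂Doubled : Σ[1≤a,b≤ m ] (B m ⇂ Doubled?) ≡ doubling m
  Σ[1≤a,b≤]-B⇂Doubled = begin
    Σ[1≤a,b≤ m ] (B m ⇂ Doubled?)
      ≡⟨ Σ[1≤a,b≤]-line m (2 *_) (B m) (λ {a} 0<a → ≤-trans 0<a (m≤n*m a 2)) ⟩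
    Σ< m (λ i → [ 2 * suc i ≤? m ]· B m (suc i) (2 * suc i))
      ≡⟨ Σ<-truncate _ (m/n≤m m 2) (λ m/2≤i _ → []·-no (2 * suc _ ≤? m) (<⇒≱ (s≤s m/2≤i) ∘ 1+i≤m/2)) ⟩
    Σ< (m / 2) (λ i → [ 2 * suc i ≤? m ]· B m (suc i) (2 * suc i))
      ≡⟨ Σ<-cong (m / 2) (λ {i} i<m/2 → []·-yes (2 * suc i ≤? m)
           (subst (_≤ m) (*-comm (suc i) 2) (Equivalence.to (≤⌊/⌋⇔*≤ (s≤s z≤n)) i<m/2))) ⟩
    Σ< (m / 2) (λ i → B m (suc i) (2 * suc i))
      ≡⟨ Σ<-cong (m / 2) (λ {i} _ → *-comm (m C suc i) (m C (2 * suc i))) ⟩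
    Σ< (m / 2) (λ i → (m C (2 * suc i)) * (m C suc i))
      ≡⟨ Σ[1≤s≤]≡Σ< (m / 2) (λ t → (m C (2 * t)) * (m C t)) ⟨
    doubling m ∎
    where
    1+i≤m/2 : ∀ {i} → 2 * suc i ≤ m → suc i ≤ m / 2
    1+i≤m/2 {i} 2i≤m = Equivalence.from (≤⌊/⌋⇔*≤ (s≤s z≤n)) (subst (_≤ m) (*-comm 2 (suc i)) 2i≤m)

  triangle-split : triangle m ≡ Σ[1≤a,b≤ m ] (B m ⇂ Cone0⅓?) + Σ[1≤a,b≤ m ] (B m ⇂ Cone⅓½?) + doubling m
  triangle-split = begin
    triangle m
      ≡⟨ Σ[1≤a,b≤]-cong m (λ {a} {b} 0<a _ → []·-split-at-double b (B m a b) 0<a) ⟩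
    Σ[1≤a,b≤ m ] (λ a b → (B m ⇂ Cone0⅓?) a b + (B m ⇂ Cone⅓½?) a b + (B m ⇂ Doubled?) a b)
      ≡⟨ Σ[1≤a,b≤]-distrib-+ m (λ a b → (B m ⇂ Cone0⅓?) a b + (B m ⇂ Cone⅓½?) a b) (B m ⇂ Doubled?) ⟩
    Σ[1≤a,b≤ m ] (λ a b → (B m ⇂ Cone0⅓?) a b + (B m ⇂ Cone⅓½?) a b) + Σ[1≤a,b≤ m ] (B m ⇂ Doubled?)
      ≡⟨ cong₂ _+_ (Σ[1≤a,b≤]-distrib-+ m (B m ⇂ Cone0⅓?) (B m ⇂ Cone⅓½?)) Σ[1≤a,b≤]-B⇂Doubled ⟩
    Σ[1≤a,b≤ m ] (B m ⇂ Cone0⅓?) + Σ[1≤a,b≤ m ] (B m ⇂ Cone⅓½?) + doubling m ∎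

  Σ[1≤a,b≤]-B+B∸⇂ : ∀ {K} (K? : Decidable K) →
                    Σ[1≤a,b≤ m ] (B+B∸ m ⇂ K?) ≡ Σ[1≤a,b≤ m ] (B m ⇂ K?) + Σ[1≤a,b≤ m ] (B∸ m ⇂ K?)
  Σ[1≤a,b≤]-B+B∸⇂ K? = trans (Σ[1≤a,b≤]-cong m (λ {a} {b} _ _ → []·-distrib-+ (K? (a , b)) (B m a b) (B∸ m a b)))
                     (Σ[1≤a,b≤]-distrib-+ m (B m ⇂ K?) (B∸ m ⇂ K?))

  Σ[1≤a,b≤]-B∸⇂Cone0⅓ : Σ[1≤a,b≤ m ] (B∸ m ⇂ Cone0⅓?) ≡ Σ[1≤a,b≤ m ] (B m ⇂ Cone⅓½?)
  Σ[1≤a,b≤]-B∸⇂Cone0⅓ = trans (Σ[1≤a,b≤]-reflect m (λ b t → (m C b) * (m C t)))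
    (Σ[1≤a,b≤]-cong m (λ {a} {b} _ _ → cong ([ Cone⅓½? (a , b) ]·_) (*-comm (m C b) (m C a))))

  Σ[1≤a,b≤]-B∸⇂Cone⅓½ : Σ[1≤a,b≤ m ] (B∸ m ⇂ Cone⅓½?) ≡ Σ[1≤a,b≤ m ] (B m ⇂ Cone0⅓?)
  Σ[1≤a,b≤]-B∸⇂Cone⅓½ = trans (sym (Σ[1≤a,b≤]-reflect m (flip (B∸ m))))
    (Σ[1≤a,b≤]-cong m (λ {a} {b} _ _ → []·-cong (Cone0⅓? (a , b)) (Cone0⅓? (a , b)) id id (λ 2a<b →
      trans (cong (λ c → (m C b) * (m C c)) (m∸[m∸n]≡n (≤-trans (m≤n*m a 2) (<⇒≤ 2a<b)))) (*-comm (m C b) (m C a)))))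

  Σ[1≤a,b≤]-B+B∸⇂Cone0⅓+doubling≡triangle : Σ[1≤a,b≤ m ] (B+B∸ m ⇂ Cone0⅓?) + doubling m ≡ triangle m
  Σ[1≤a,b≤]-B+B∸⇂Cone0⅓+doubling≡triangle = begin
    Σ[1≤a,b≤ m ] (B+B∸ m ⇂ Cone0⅓?) + doubling m
      ≡⟨ cong (_+ doubling m) (trans (Σ[1≤a,b≤]-B+B∸⇂ Cone0⅓?)
                                     (cong (Σ[1≤a,b≤ m ] (B m ⇂ Cone0⅓?) +_) Σ[1≤a,b≤]-B∸⇂Cone0⅓)) ⟩
    Σ[1≤a,b≤ m ] (B m ⇂ Cone0⅓?) + Σ[1≤a,b≤ m ] (B m ⇂ Cone⅓½?) + doubling m
      ≡⟨ triangle-split ⟨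
    triangle m ∎

  Σ[1≤a,b≤]-B+B∸⇂Cone⅓½+doubling≡triangle : Σ[1≤a,b≤ m ] (B+B∸ m ⇂ Cone⅓½?) + doubling m ≡ triangle m
  Σ[1≤a,b≤]-B+B∸⇂Cone⅓½+doubling≡triangle = begin
    Σ[1≤a,b≤ m ] (B+B∸ m ⇂ Cone⅓½?) + doubling m
      ≡⟨ cong (_+ doubling m) (trans (Σ[1≤a,b≤]-B+B∸⇂ Cone⅓½?)
           (trans (cong (Σ[1≤a,b≤ m ] (B m ⇂ Cone⅓½?) +_) Σ[1≤a,b≤]-B∸⇂Cone⅓½) (+-comm (Σ[1≤a,b≤ m ] (B m ⇂ Cone⅓½?)) _))) ⟩
    Σ[1≤a,b≤ m ] (B m ⇂ Cone0⅓?) + Σ[1≤a,b≤ m ] (B m ⇂ Cone⅓½?) + doubling m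
      ≡⟨ triangle-split ⟨
    triangle m ∎

s*[k∸2h]≡s*[k∸h]∸s*h : ∀ s h k → s * (k ∸ 2 * h) ≡ s * (k ∸ h) ∸ s * h
s*[k∸2h]≡s*[k∸h]∸s*h s h k = begin
  s * (k ∸ 2 * h)       ≡⟨ cong (λ c → s * (k ∸ c)) (2*n≡n+n h) ⟩
  s * (k ∸ (h + h))     ≡⟨ cong (s *_) (∸-+-assoc k h h) ⟨
  s * (k ∸ h ∸ h)       ≡⟨ *-distribˡ-∸ s (k ∸ h) h ⟩
  s * (k ∸ h) ∸ s * h   ∎

s*[2h∸k]≡s*h∸s*[k∸h] : ∀ s {h k} → h ≤ k → s * (2 * h ∸ k) ≡ s * h ∸ s * (k ∸ h)
s*[2h∸k]≡s*h∸s*[k∸h] s {h} {k} h≤k = begin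
  s * (2 * h ∸ k)             ≡⟨ cong₂ (λ c d → s * (c ∸ d)) (2*n≡n+n h) (sym (m+[n∸m]≡n h≤k)) ⟩
  s * (h + h ∸ (h + (k ∸ h))) ≡⟨ cong (s *_) ([m+n]∸[m+o]≡n∸o h h (k ∸ h)) ⟩
  s * (h ∸ (k ∸ h))           ≡⟨ *-distribˡ-∸ s h (k ∸ h) ⟩
  s * h ∸ s * (k ∸ h)         ∎

module _ (m : ℕ) where

  summand≡B+B∸ : ∀ a b {c} → b ∸ a ≡ c → B+B∸ m a b ≡ (m C b) * ((m C a) + (m C c))
  summand≡B+B∸ a b refl = sym (trans (*-distribˡ-+ (m C b) (m C a) _) (cong (_+ B∸ m a b) (*-comm (m C b) (m C a))))

  summand≡flip-B+B∸ : ∀ a b {c} → a ∸ b ≡ c → B+B∸ m b a ≡ (m C a) * ((m C b) + (m C c))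
  summand≡flip-B+B∸ a b refl = sym (trans (*-distribˡ-+ (m C a) (m C b) _) (cong (_+ B∸ m b a) (*-comm (m C a) (m C b))))

  ΣFB-I01 : ΣFB m I01? (λ h k → Σ[1≤s≤ ⌊ m / h ⌋ ⊓ ⌊ m / (k ∸ h) ⌋ ] (λ s → (m C (s * h)) * (m C (s * (k ∸ h)))))
            ≡ Σ[1≤a,b≤ m ] (B m)
  ΣFB-I01 = farey-grid m I01? (λ _ → yes tt) I01-cone (B m)

  ΣFB-I0½ : ΣFB m I0½? (λ h k → Σ[1≤s≤ ⌊ m / (k ∸ h) ⌋ ] (λ s → (m C (s * h)) * (m C (s * (k ∸ h)))))
            ≡ triangle m
  ΣFB-I0½ = farey-grid-⌊m/[k∸h]⌋ m I0½? Cone0½? I0½-cone _ (B m) (λ _ _ → refl) <⇒≤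

  ΣFB-I½1 : ΣFB m I½1? (λ h k → Σ[1≤s≤ ⌊ m / h ⌋ ] (λ s → (m C (s * h)) * (m C (s * (k ∸ h)))))
            ≡ triangle m
  ΣFB-I½1 = trans (farey-grid-⌊m/h⌋ m I½1? Cone½1? I½1-cone _ (B m) (λ _ _ → refl) <⇒≤)
                  (Σ[1≤a,b≤]-B⇂Cone½1≡triangle m)

  ΣFB-I0⅓ : ΣFB m I0⅓? (λ h k → Σ[1≤s≤ ⌊ m / (k ∸ h) ⌋ ] (λ s → (m C (s * (k ∸ h))) * ((m C (s * h)) + (m C (s * (k ∸ 2 * h))))))
            ≡ Σ[1≤a,b≤ m ] (B+B∸ m ⇂ Cone0⅓?)
  ΣFB-I0⅓ = farey-grid-⌊m/[k∸h]⌋ m I0⅓? Cone0⅓? I0⅓-cone _ (B+B∸ m)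
    (λ {h} {k} _ s → summand≡B+B∸ (s * h) (s * (k ∸ h)) (sym (s*[k∸2h]≡s*[k∸h]∸s*h s h k)))
    (λ 2a<b → ≤-trans (m≤n*m _ 2) (<⇒≤ 2a<b))

  ΣFB-I⅓½ : ΣFB m I⅓½? (λ h k → Σ[1≤s≤ ⌊ m / (k ∸ h) ⌋ ] (λ s → (m C (s * (k ∸ h))) * ((m C (s * h)) + (m C (s * (k ∸ 2 * h))))))
            ≡ Σ[1≤a,b≤ m ] (B+B∸ m ⇂ Cone⅓½?)
  ΣFB-I⅓½ = farey-grid-⌊m/[k∸h]⌋ m I⅓½? Cone⅓½? I⅓½-cone _ (B+B∸ m)
    (λ {h} {k} _ s → summand≡B+B∸ (s * h) (s * (k ∸ h)) (sym (s*[k∸2h]≡s*[k∸h]∸s*h s h k)))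
    (λ c → <⇒≤ (proj₂ c))

  ΣFB-I½⅔ : ΣFB m I½⅔? (λ h k → Σ[1≤s≤ ⌊ m / h ⌋ ] (λ s → (m C (s * h)) * ((m C (s * (k ∸ h))) + (m C (s * (2 * h ∸ k))))))
            ≡ Σ[1≤a,b≤ m ] (B+B∸ m ⇂ Cone⅓½?)
  ΣFB-I½⅔ = trans (farey-grid-⌊m/h⌋ m I½⅔? Cone½⅔? I½⅔-cone _ (flip (B+B∸ m))
                    (λ {h} {k} p s → summand≡flip-B+B∸ (s * h) (s * (k ∸ h))
                                       (sym (s*[2h∸k]≡s*h∸s*[k∸h] s (<⇒≤ (proj₂ (IsConeOver.positive I½⅔-cone p))))))
                    (λ c → <⇒≤ (proj₂ c)))
                  (Σ[1≤a,b≤]-comm m (flip (B+B∸ m) ⇂ Cone½⅔?))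

  ΣFB-I⅔1 : ΣFB m I⅔1? (λ h k → Σ[1≤s≤ ⌊ m / h ⌋ ] (λ s → (m C (s * h)) * ((m C (s * (k ∸ h))) + (m C (s * (2 * h ∸ k))))))
            ≡ Σ[1≤a,b≤ m ] (B+B∸ m ⇂ Cone0⅓?)
  ΣFB-I⅔1 = trans (farey-grid-⌊m/h⌋ m I⅔1? Cone⅔1? I⅔1-cone _ (flip (B+B∸ m))
                    (λ {h} {k} p s → summand≡flip-B+B∸ (s * h) (s * (k ∸ h))
                                       (sym (s*[2h∸k]≡s*h∸s*[k∸h] s (<⇒≤ (proj₂ (IsConeOver.positive I⅔1-cone p))))))
                    (λ 2b<a → ≤-trans (m≤n*m _ 2) (<⇒≤ 2b<a)))
                  (Σ[1≤a,b≤]-comm m (flip (B+B∸ m) ⇂ Cone⅔1?))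


-- Closed forms

x*x≡[1+x]²∸[1+x]*2+1 : ∀ x → 0 < x → x * x ≡ (1 + x) * (1 + x) ∸ (1 + x) * 2 + 1
x*x≡[1+x]²∸[1+x]*2+1 (suc y) _ = begin
  suc (y + y * suc y)                              ≡⟨ +-comm 1 z ⟩
  z + 1                                            ≡⟨ cong (_+ 1) (m+n∸n≡m z ((2 + y) * 2)) ⟨
  z + (2 + y) * 2 ∸ (2 + y) * 2 + 1                ≡⟨ cong (λ c → c ∸ (2 + y) * 2 + 1) (square y) ⟨
  (2 + y) * (2 + y) ∸ (2 + y) * 2 + 1              ∎
  where
  z : ℕ
  z = y + y * suc y
  open ℕ-Solver.+-*-Solver
  square : ∀ y → (2 + y) * (2 + y) ≡ y + y * suc y + (2 + y) * 2
  square = solve 1 (λ y → (con 2 :+ y) :* (con 2 :+ y) := y :+ y :* (con 1 :+ y) :+ (con 2 :+ y) :* con 2) refl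

2^[2n∸1]+2^[2n∸1]≡2^n*2^n : ∀ n → 0 < n → 2 ^ (2 * n ∸ 1) + 2 ^ (2 * n ∸ 1) ≡ 2 ^ n * 2 ^ n
2^[2n∸1]+2^[2n∸1]≡2^n*2^n n@(suc n-1) _ = begin
  2 ^ (2 * n ∸ 1) + 2 ^ (2 * n ∸ 1)        ≡⟨ cong (2 ^ (2 * n ∸ 1) +_) (+-identityʳ _) ⟨
  2 ^ suc (2 * n ∸ 1)                      ≡⟨ cong (λ e → 2 ^ suc (n-1 + e)) (+-identityʳ n) ⟩
  2 ^ (n + n)                              ≡⟨ ^-distribˡ-+-* 2 n n ⟩
  2 ^ n * 2 ^ n                            ∎

Σ[1≤a,b≤]-B≡2^[2m]∸2^[m+1]+1 : ∀ m → 0 < m → Σ[1≤a,b≤ m ] (B m) ≡ 2 ^ (2 * m) ∸ 2 ^ (m + 1) + 1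
Σ[1≤a,b≤]-B≡2^[2m]∸2^[m+1]+1 m@(suc _) 0<m = begin
  Σ[1≤a,b≤ m ] (B m)                     ≡⟨ Σ[1≤a,b≤]-B m ⟩
  x * x                                  ≡⟨ x*x≡[1+x]²∸[1+x]*2+1 x 0<x ⟩
  (1 + x) * (1 + x) ∸ (1 + x) * 2 + 1    ≡⟨ cong (λ w → w * w ∸ w * 2 + 1) (Σ[i≤n]nCi≡2^n m) ⟩
  2 ^ m * 2 ^ m ∸ 2 ^ m * 2 + 1          ≡⟨ cong₂ (λ u v → u ∸ v + 1) (^-distribˡ-+-* 2 m m) (^-distribˡ-+-* 2 m 1) ⟨
  2 ^ (m + m) ∸ 2 ^ (m + 1) + 1          ≡⟨ cong (λ e → 2 ^ (m + e) ∸ 2 ^ (m + 1) + 1) (+-identityʳ m) ⟨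
  2 ^ (2 * m) ∸ 2 ^ (m + 1) + 1          ∎
  where
  x : ℕ
  x = Σ< m (λ i → m C suc i)
  0<x : 0 < x
  0<x = ≤-trans (≤-trans 0<m (≤-reflexive (sym (nC1≡n m)))) (m≤m+n (m C 1) _)

ℕ→ℚ≡mkℚ : ∀ n → ℕ→ℚ n ≡ mkℚ (ℤ.+ n) 0 (Coprime.sym (1-coprimeTo n))
ℕ→ℚ≡mkℚ n = ↥p/↧p≡p (mkℚ (ℤ.+ n) 0 (Coprime.sym (1-coprimeTo n)))

ℕ→ℚ-+ : ∀ a b → ℕ→ℚ (a + b) ≡ ℕ→ℚ a +ℚ ℕ→ℚ b
ℕ→ℚ-+ a b = trans (/-cong +[a+b]≡a*1+b*1 refl) (sym (cong₂ _+ℚ_ (ℕ→ℚ≡mkℚ a) (ℕ→ℚ≡mkℚ b)))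
  where
  +[a+b]≡a*1+b*1 : ℤ.+ (a + b) ≡ ℤ.+ a ℤ.* ℤ.+ 1 ℤ.+ ℤ.+ b ℤ.* ℤ.+ 1
  +[a+b]≡a*1+b*1 = trans (ℤ.pos-+ a b) (sym (cong₂ ℤ._+_ (ℤ.*-identityʳ (ℤ.+ a)) (ℤ.*-identityʳ (ℤ.+ b))))

ℕ→ℚ-* : ∀ a b → ℕ→ℚ (a * b) ≡ ℕ→ℚ a *ℚ ℕ→ℚ b
ℕ→ℚ-* a b = trans (/-cong (ℤ.pos-* a b) refl) (sym (cong₂ _*ℚ_ (ℕ→ℚ≡mkℚ a) (ℕ→ℚ≡mkℚ b)))

closed-form : ℕ → ℚ
closed-form m = ℕ→ℚ (2 ^ (2 * m ∸ 1)) -ℚ ℕ→ℚ (2 ^ m) -ℚ ½ *ℚ ℕ→ℚ ((2 * m) C m)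

solve-a+a+v≡x² : ∀ (a v x h : ℚ) → a +ℚ a +ℚ v ≡ x *ℚ x → h +ℚ h ≡ (1ℚ +ℚ x) *ℚ (1ℚ +ℚ x) →
               a ≡ h -ℚ (1ℚ +ℚ x) -ℚ ½ *ℚ (1ℚ +ℚ v) +ℚ 1ℚ
solve-a+a+v≡x² a v x h a+a+v≡x² h+h≡[1+x]² = begin
  a                                                        ≡⟨ halve a v ⟩
  ½ *ℚ (a +ℚ a +ℚ v -ℚ v)                                  ≡⟨ cong (λ y → ½ *ℚ (y -ℚ v)) a+a+v≡x² ⟩
  ½ *ℚ (x *ℚ x -ℚ v)                                       ≡⟨ expand x v ⟩
  ½ *ℚ ((1ℚ +ℚ x) *ℚ (1ℚ +ℚ x)) -ℚ (1ℚ +ℚ x) -ℚ ½ *ℚ (1ℚ +ℚ v) +ℚ 1ℚ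
    ≡⟨ cong (λ y → ½ *ℚ y -ℚ (1ℚ +ℚ x) -ℚ ½ *ℚ (1ℚ +ℚ v) +ℚ 1ℚ) h+h≡[1+x]² ⟨
  ½ *ℚ (h +ℚ h) -ℚ (1ℚ +ℚ x) -ℚ ½ *ℚ (1ℚ +ℚ v) +ℚ 1ℚ
    ≡⟨ cong (λ y → y -ℚ (1ℚ +ℚ x) -ℚ ½ *ℚ (1ℚ +ℚ v) +ℚ 1ℚ) (halve′ h) ⟩
  h -ℚ (1ℚ +ℚ x) -ℚ ½ *ℚ (1ℚ +ℚ v) +ℚ 1ℚ                   ∎
  where
  open ℚ-Solver.+-*-Solver
  halve : ∀ a v → a ≡ ½ *ℚ (a +ℚ a +ℚ v -ℚ v)
  halve = solve 2 (λ a v → a := con ½ :* (a :+ a :+ v :- v)) refl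
  expand : ∀ x v → ½ *ℚ (x *ℚ x -ℚ v)
                 ≡ ½ *ℚ ((1ℚ +ℚ x) *ℚ (1ℚ +ℚ x)) -ℚ (1ℚ +ℚ x) -ℚ ½ *ℚ (1ℚ +ℚ v) +ℚ 1ℚ
  expand = solve 2 (λ x v → con ½ :* (x :* x :- v)
                          := con ½ :* ((con 1ℚ :+ x) :* (con 1ℚ :+ x)) :- (con 1ℚ :+ x)
                             :- con ½ :* (con 1ℚ :+ v) :+ con 1ℚ) refl
  halve′ : ∀ h → ½ *ℚ (h +ℚ h) ≡ h
  halve′ = solve 1 (λ h → con ½ :* (h :+ h) := h) refl

triangle≡closed-form+1 : ∀ m → 0 < m → ℕ→ℚ (triangle m) ≡ closed-form m +ℚ 1ℚ
triangle≡closed-form+1 m 0<m = begin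
  ℕ→ℚ (triangle m)
    ≡⟨ solve-a+a+v≡x² (ℕ→ℚ (triangle m)) (ℕ→ℚ V) (ℕ→ℚ x) (ℕ→ℚ (2 ^ (2 * m ∸ 1))) (begin
         ℕ→ℚ (triangle m) +ℚ ℕ→ℚ (triangle m) +ℚ ℕ→ℚ V   ≡⟨ cong (_+ℚ ℕ→ℚ V) (ℕ→ℚ-+ (triangle m) (triangle m)) ⟨
         ℕ→ℚ (triangle m + triangle m) +ℚ ℕ→ℚ V          ≡⟨ ℕ→ℚ-+ (triangle m + triangle m) V ⟨
         ℕ→ℚ (triangle m + triangle m + V)               ≡⟨ cong ℕ→ℚ (trans (triangle+triangle+Σ[1≤a≤m]mCa² m) (Σ[1≤a,b≤]-B m)) ⟩
         ℕ→ℚ (x * x)                               ≡⟨ ℕ→ℚ-* x x ⟩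
         ℕ→ℚ x *ℚ ℕ→ℚ x                            ∎)
       (begin
         ℕ→ℚ H +ℚ ℕ→ℚ H                            ≡⟨ ℕ→ℚ-+ H H ⟨
         ℕ→ℚ (H + H)                               ≡⟨ cong ℕ→ℚ (2^[2n∸1]+2^[2n∸1]≡2^n*2^n m 0<m) ⟩
         ℕ→ℚ (2 ^ m * 2 ^ m)                       ≡⟨ ℕ→ℚ-* (2 ^ m) (2 ^ m) ⟩
         ℕ→ℚ (2 ^ m) *ℚ ℕ→ℚ (2 ^ m)                ≡⟨ cong (λ w → w *ℚ w) 1+x≡2^m ⟨
         (1ℚ +ℚ ℕ→ℚ x) *ℚ (1ℚ +ℚ ℕ→ℚ x)            ∎) ⟩
  ℕ→ℚ H -ℚ (1ℚ +ℚ ℕ→ℚ x) -ℚ ½ *ℚ (1ℚ +ℚ ℕ→ℚ V) +ℚ 1ℚ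
    ≡⟨ cong₂ (λ w c → ℕ→ℚ H -ℚ w -ℚ ½ *ℚ c +ℚ 1ℚ) 1+x≡2^m 1+V≡[2m]Cm ⟩
  closed-form m +ℚ 1ℚ ∎
  where
  x V H : ℕ
  x = Σ< m (λ i → m C suc i)
  V = Σ< m (λ i → (m C suc i) * (m C suc i))
  H = 2 ^ (2 * m ∸ 1)
  1+x≡2^m : 1ℚ +ℚ ℕ→ℚ x ≡ ℕ→ℚ (2 ^ m)
  1+x≡2^m = trans (sym (ℕ→ℚ-+ 1 x)) (cong ℕ→ℚ (Σ[i≤n]nCi≡2^n m))
  1+V≡[2m]Cm : 1ℚ +ℚ ℕ→ℚ V ≡ ℕ→ℚ ((2 * m) C m)
  1+V≡[2m]Cm = trans (sym (ℕ→ℚ-+ 1 V)) (cong ℕ→ℚ (Σ[i≤n]nCi²≡[2n]Cn m))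

+doubling≡triangle⇒≡closed-form-doubling+1 : ∀ m {y} → 0 < m → y + doubling m ≡ triangle m →
                           ℕ→ℚ y ≡ closed-form m -ℚ ℕ→ℚ (doubling m) +ℚ 1ℚ
+doubling≡triangle⇒≡closed-form-doubling+1 m {y} 0<m y+d≡triangle = begin
  ℕ→ℚ y                                          ≡⟨ cancel (ℕ→ℚ y) (ℕ→ℚ (doubling m)) ⟩
  ℕ→ℚ y +ℚ ℕ→ℚ (doubling m) -ℚ ℕ→ℚ (doubling m)
    ≡⟨ cong (_-ℚ ℕ→ℚ (doubling m)) (trans (sym (ℕ→ℚ-+ y (doubling m))) (cong ℕ→ℚ y+d≡triangle)) ⟩
  ℕ→ℚ (triangle m) -ℚ ℕ→ℚ (doubling m)               ≡⟨ cong (_-ℚ ℕ→ℚ (doubling m)) (triangle≡closed-form+1 m 0<m) ⟩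
  closed-form m +ℚ 1ℚ -ℚ ℕ→ℚ (doubling m)         ≡⟨ swap-last (closed-form m) (ℕ→ℚ (doubling m)) ⟩
  closed-form m -ℚ ℕ→ℚ (doubling m) +ℚ 1ℚ         ∎
  where
  open ℚ-Solver.+-*-Solver
  cancel : ∀ y d → y ≡ y +ℚ d -ℚ d
  cancel = solve 2 (λ y d → y := y :+ d :- d) refl
  swap-last : ∀ e d → e +ℚ 1ℚ -ℚ d ≡ e -ℚ d +ℚ 1ℚ
  swap-last = solve 2 (λ e d → e :+ con 1ℚ :- d := e :- d :+ con 1ℚ) refl

proposition7 : (m : ℕ) → 1 < m →
    (ΣFB m I01? (λ h k → Σ[1≤s≤ ⌊ m / h ⌋ ⊓ ⌊ m / (k ∸ h) ⌋ ] (λ s → (m C (s * h)) * (m C (s * (k ∸ h)))))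
      ≡ 2 ^ (2 * m) ∸ 2 ^ (m + 1) + 1)
  × (ℕ→ℚ (ΣFB m I0½? (λ h k → Σ[1≤s≤ ⌊ m / (k ∸ h) ⌋ ] (λ s → (m C (s * h)) * (m C (s * (k ∸ h))))))
      ≡ ℕ→ℚ (2 ^ (2 * m ∸ 1)) -ℚ ℕ→ℚ (2 ^ m) -ℚ ½ *ℚ ℕ→ℚ ((2 * m) C m) +ℚ ℕ→ℚ 1)
  × (ℕ→ℚ (ΣFB m I½1? (λ h k → Σ[1≤s≤ ⌊ m / h ⌋ ] (λ s → (m C (s * h)) * (m C (s * (k ∸ h))))))
      ≡ ℕ→ℚ (2 ^ (2 * m ∸ 1)) -ℚ ℕ→ℚ (2 ^ m) -ℚ ½ *ℚ ℕ→ℚ ((2 * m) C m) +ℚ ℕ→ℚ 1)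
  × (ℕ→ℚ (ΣFB m I0⅓? (λ h k → Σ[1≤s≤ ⌊ m / (k ∸ h) ⌋ ] (λ s → (m C (s * (k ∸ h))) * ((m C (s * h)) + (m C (s * (k ∸ 2 * h)))))))
      ≡ ℕ→ℚ (2 ^ (2 * m ∸ 1)) -ℚ ℕ→ℚ (2 ^ m) -ℚ ½ *ℚ ℕ→ℚ ((2 * m) C m)
        -ℚ ℕ→ℚ (Σ[1≤s≤ ⌊ m / 2 ⌋ ] (λ t → (m C (2 * t)) * (m C t))) +ℚ ℕ→ℚ 1)
  × (ℕ→ℚ (ΣFB m I⅓½? (λ h k → Σ[1≤s≤ ⌊ m / (k ∸ h) ⌋ ] (λ s → (m C (s * (k ∸ h))) * ((m C (s * h)) + (m C (s * (k ∸ 2 * h)))))))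
      ≡ ℕ→ℚ (2 ^ (2 * m ∸ 1)) -ℚ ℕ→ℚ (2 ^ m) -ℚ ½ *ℚ ℕ→ℚ ((2 * m) C m)
        -ℚ ℕ→ℚ (Σ[1≤s≤ ⌊ m / 2 ⌋ ] (λ t → (m C (2 * t)) * (m C t))) +ℚ ℕ→ℚ 1)
  × (ℕ→ℚ (ΣFB m I½⅔? (λ h k → Σ[1≤s≤ ⌊ m / h ⌋ ] (λ s → (m C (s * h)) * ((m C (s * (k ∸ h))) + (m C (s * (2 * h ∸ k)))))))
      ≡ ℕ→ℚ (2 ^ (2 * m ∸ 1)) -ℚ ℕ→ℚ (2 ^ m) -ℚ ½ *ℚ ℕ→ℚ ((2 * m) C m)
        -ℚ ℕ→ℚ (Σ[1≤s≤ ⌊ m / 2 ⌋ ] (λ t → (m C (2 * t)) * (m C t))) +ℚ ℕ→ℚ 1)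
  × (ℕ→ℚ (ΣFB m I⅔1? (λ h k → Σ[1≤s≤ ⌊ m / h ⌋ ] (λ s → (m C (s * h)) * ((m C (s * (k ∸ h))) + (m C (s * (2 * h ∸ k)))))))
      ≡ ℕ→ℚ (2 ^ (2 * m ∸ 1)) -ℚ ℕ→ℚ (2 ^ m) -ℚ ½ *ℚ ℕ→ℚ ((2 * m) C m)
        -ℚ ℕ→ℚ (Σ[1≤s≤ ⌊ m / 2 ⌋ ] (λ t → (m C (2 * t)) * (m C t))) +ℚ ℕ→ℚ 1)
proposition7 m 1<m =
    trans (ΣFB-I01 m) (Σ[1≤a,b≤]-B≡2^[2m]∸2^[m+1]+1 m 0<m)
  , trans (cong ℕ→ℚ (ΣFB-I0½ m)) (triangle≡closed-form+1 m 0<m)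
  , trans (cong ℕ→ℚ (ΣFB-I½1 m)) (triangle≡closed-form+1 m 0<m)
  , trans (cong ℕ→ℚ (ΣFB-I0⅓ m)) (via-triangle (Σ[1≤a,b≤]-B+B∸⇂Cone0⅓+doubling≡triangle m))
  , trans (cong ℕ→ℚ (ΣFB-I⅓½ m)) (via-triangle (Σ[1≤a,b≤]-B+B∸⇂Cone⅓½+doubling≡triangle m))
  , trans (cong ℕ→ℚ (ΣFB-I½⅔ m)) (via-triangle (Σ[1≤a,b≤]-B+B∸⇂Cone⅓½+doubling≡triangle m))
  , trans (cong ℕ→ℚ (ΣFB-I⅔1 m)) (via-triangle (Σ[1≤a,b≤]-B+B∸⇂Cone0⅓+doubling≡triangle m))
  where
  0<m : 0 < m
  0<m = <⇒≤ 1<m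
  via-triangle : ∀ {y} → y + doubling m ≡ triangle m → ℕ→ℚ y ≡ closed-form m -ℚ ℕ→ℚ (doubling m) +ℚ 1ℚ
  via-triangle = +doubling≡triangle⇒≡closed-form-doubling+1 m 0<m
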